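{- Fix integers $k\geq 0$ and $\ell\geq 1$. Then: (1) for $0\leq m\leq \ell$, $\nu^m(\mathbb{I}_{k,\ell})$ is defined; (2) for $0\leq m\leq \ell$, $\mathrm{def}(\nu^m(\mathbb{I}_{k,\ell}))=k$; (3) for $0\leq m\leq \ell$, $\mathrm{dinv}(\nu^m(\mathbb{I}_{k,\ell}))=\binom{\ell+1}{2}+m$; (4) for $0\leq m\leq r_{ -k,\ell}$, $\Delta(\nu^m(\mathbb{I}_{k,\ell}))=\ell+\lceil k/\ell\rceil+1$; (5) for $1+r_{ -k,\ell}\leq m\leq \ell$, $\Delta(\nu^m(\mathbb{I}_{k,\ell}))=\ell+\lceil k/\ell\rceil+2$.
   Context: Partitions $\gamma=(\gamma_1\geq\gamma_2\geq\cdots\geq 0)$ are identified up to trailing zeros; $\ell(\gamma)$ is the number of nonzero parts and $|\gamma|$ the sum of parts. The diagram of $\gamma$ is $\{(i,j):1\leq i\leq \ell(\gamma),1\leq j\leq\gamma_i\}$ (row $i$ from the top). For a cell $c=(i,j)$, $\mathrm{arm}(c)=\gamma_i-j$ and $\mathrm{leg}(c)=\gamma'_j-i$, where $\gamma'$ is the conjugate partition. $\mathrm{dinv}(\gamma)$ is the number of cells $c$ with $\mathrm{arm}(c)-\mathrm{leg}(c)\in\{0,1\}$, and $\mathrm{def}(\gamma)=|\gamma|-\mathrm{dinv}(\gamma)$. A partition $\gamma$ is a Dyck partition of order $n$ ($\gamma\in\mathrm{DP}_n$) if its diagram is contained in that of the staircase $(n-1,n-2,\ldots,1,0)$; $\Delta(\gamma)$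 is the least $n$ with $\gamma\in\mathrm{DP}_n$. If $\gamma_1\leq\ell(\gamma)+2$, define $\nu(\gamma)=(\ell(\gamma)+1,\gamma_1-1,\gamma_2-1,\ldots,\gamma_{\ell(\gamma)}-1)$ (otherwise $\nu(\gamma)$ is undefined); $\nu^m$ is the $m$-fold iterate. For integers $j$ and $\ell>0$, $r_{j,\ell}=j-\ell\lfloor j/\ell\rfloor\in\{0,\ldots,\ell-1\}$. Notation: $\underline{c}^d$ is $d$ copies of $c$, $(\ell-1)\searrow 1$ is the sequence $(\ell-1,\ell-2,\ldots,1)$, and sums of sequences are entrywise after padding with zeros. For $k\geq 0,\ell>0$, $\mathbb{I}_{k,\ell}=(\underline{\ell}^{1+\lfloor k/\ell\rfloor},(\ell-1)\searrow 1)+(\underline{0}^{1+\lfloor k/\ell\rfloor},\underline{1}^{r_{k,\ell}},\underline{0}^{\ell-1-r_{k,\ell}})$. -}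

module Defs where

open import Data.Nat using (ℕ; zero; suc; _+_; _*_; _∸_; _≤_; _≤?_; _≟_; NonZero)
open import Data.Nat.DivMod using (_/_; _%_)
open import Data.Integer as ℤ using (ℤ; +_; -_)
open import Data.Integer.DivMod using (_%ℕ_)
open import Data.List using (List; []; _∷_; length; filter; replicate; _++_; map; zip; upTo; head)
open import Data.Nat.ListAction using (sum)
open import Data.List.Relation.Unary.All using (All)
open import Data.Maybe using (Maybe; just; nothing; _>>=_)
open import Data.Product using (_×_; _,_)
open import Data.Sum using (_⊎_)
open import Relation.Binary.PropositionalEquality using (_≡_)
open import Relation.Nullary using (¬_)
open import Relation.Nullary.Decidable using (¬?; _⊎-dec_)

-- A partition is a weakly decreasing list of parts; zero parts are
-- treated as (trailing) zeros and are stripped where they may arise.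
Partition : Set
Partition = List ℕ

strip : Partition → Partition
strip = filter (λ p → ¬? (p ≟ 0))

len : Partition → ℕ
len γ = length (strip γ)

size : Partition → ℕ
size = sum

first : Partition → ℕ
first [] = 0
first (p ∷ _) = p

conj : Partition → ℕ → ℕ
conj γ j = length (filter (λ p → j ≤? p) γ)

oneTo : ℕ → List ℕ
oneTo n = map suc (upTo n)

rows : Partition → List (ℕ × ℕ)
rows γ = zip (oneTo (length γ)) γ

-- arm(i,j) = γ_i - j, leg(i,j) = γ'_j - i  (for cells, both are ≥ 0)
-- cell (i,j) with row length p counts for dinv iff arm - leg ∈ {0,1}
dinvRow : Partition → ℕ → ℕ → ℕ
dinvRow γ i p =
  length (filter (λ j → ((p ∸ j) ≟ (conj γ j ∸ i)) ⊎-dec ((p ∸ j) ≟ suc (conj γ j ∸ i))) (oneTo p))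

dinvAux : Partition → List (ℕ × ℕ) → ℕ
dinvAux γ [] = 0
dinvAux γ ((i , p) ∷ rs) = dinvRow γ i p + dinvAux γ rs

dinv : Partition → ℕ
dinv γ = dinvAux γ (rows γ)

def : Partition → ℤ
def γ = + size γ ℤ.- + dinv γ

-- γ ∈ DP_n : diagram contained in staircase (n-1, n-2, …, 1, 0),
-- i.e. for every row i (1-indexed), γ_i ≤ n - i  (row i of the staircase
-- has length n - i for i ≤ n, and is empty for i ≥ n).
DP : ℕ → Partition → Set
DP n γ = All (λ { (i , p) → p ≤ n ∸ i }) (rows γ)

IsΔ : Partition → ℕ → Set
IsΔ γ n = DP n γ × (∀ m → DP m γ → n ≤ m)

ν : Partition → Maybe Partition
ν γ with first γ ≤? len γ + 2
... | Relation.Nullary.yes _ = just (strip (suc (len γ) ∷ map (λ p → p ∸ 1) (strip γ)))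
... | Relation.Nullary.no  _ = nothing

νIter : ℕ → Partition → Maybe Partition
νIter zero    γ = just γ
νIter (suc m) γ = νIter m γ >>= ν

down : ℕ → List ℕ
down zero    = []
down (suc n) = suc n ∷ down n

addPad : List ℕ → List ℕ → List ℕ
addPad []       ys       = ys
addPad xs       []       = xs
addPad (x ∷ xs) (y ∷ ys) = (x + y) ∷ addPad xs ys

r : ℤ → (ℓ : ℕ) → .{{NonZero ℓ}} → ℕ
r j ℓ = j %ℕ ℓ

ceilDiv : ℕ → (ℓ : ℕ) → .{{NonZero ℓ}} → ℕ
ceilDiv k ℓ = (k + (ℓ ∸ 1)) / ℓ

𝕀 : ℕ → (ℓ : ℕ) → .{{NonZero ℓ}} → Partition
𝕀 k ℓ = addPad (replicate (suc (k / ℓ)) ℓ ++ down (ℓ ∸ 1))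
               (replicate (suc (k / ℓ)) 0 ++ replicate (r (+ k) ℓ) 1
                  ++ replicate (ℓ ∸ 1 ∸ r (+ k) ℓ) 0)

-- The general fact behind it is that ν raises dinv and the size by one
-- wherever it is defined (dinv-νStep, size-νStep).  After expressing dinv
-- and conjugates through finite sums of indicators, the comparison of the
-- new top row of ν(γ) with the first column of γ reduces to a crossing
-- identity: the boundary of a diagram meets every anti-diagonal exactly once,
-- at a row end or at a column end (diagonal-crossing).  Next, the iterates of
-- ν on a descending positive I are described as m new rows above I with m
-- columns removed (IterateFacts); since Δ is the largest diagonal γ_i + i
-- (Δ-from-diagonals), Δ along the iteration is read off from the lengths of
-- the new rows (IterateΔ).  Finally 𝕀_{k,ℓ} is q + 1 full rows above a
-- bumped staircase (shapeI); its dinv, size, column heights and diagonals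
-- are computed, and the rounding of k/ℓ (Rounding) yields the theorem.
module Submission where

open import Defs
open import Data.Nat using (ℕ; zero; suc; _+_; _*_; _∸_; _≤_; _<_; _≥_; _≤?_; _<?_; _≟_; z≤n; s≤s; NonZero)
open import Data.Nat.Properties
open import Data.Nat.DivMod using (_/_; _%_; m%n<n; +-distrib-/; m<n⇒m%n≡m; m*n%n≡0; m*n/n≡m; m≡m%n+[m/n]*n; m<n⇒m/n≡0)
open import Data.Nat.Combinatorics using (_C_; nC1≡n; nCk+nC[k+1]≡[n+1]C[k+1])
open import Data.Nat.ListAction using (sum)
open import Data.Nat.ListAction.Properties using (sum-++)
open import Data.Nat.Solver using (module +-*-Solver)
import Data.Integer as ℤ
import Data.Integer.Properties as ℤ
open import Data.List using (List; []; _∷_; length; filter; replicate; _++_; map; zip; applyUpTo)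
open import Data.List.Properties using (map-applyUpTo; filter-all; filter-++; filter-none; filter-accept; map-id; map-++; length-map; length-++; length-replicate)
open import Data.List.Relation.Unary.All as All using (All; []; _∷_)
import Data.List.Relation.Unary.All.Properties as All
open import Data.List.Relation.Unary.AllPairs as AllPairs using (AllPairs; []; _∷_)
import Data.List.Relation.Unary.AllPairs.Properties as AllPairs
open import Data.List.Relation.Unary.Any using (Any; here; there)
open import Data.List.Relation.Unary.Any.Properties using (++⁺ˡ; ++⁺ʳ)
open import Data.Maybe using (just; _>>=_)
open import Data.Product using (_×_; _,_; proj₁; proj₂; Σ)
open import Data.Sum using (inj₁; inj₂)
open import Data.Empty using (⊥-elim)
open import Function using (_∘_; id)
open import Relation.Binary.Definitions using (tri<; tri≈; tri>)
open import Relation.Binary.PropositionalEquality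
open import Relation.Nullary using (Dec; yes; no; ¬_)
open import Relation.Nullary.Decidable using (¬?; _⊎-dec_)
open import Relation.Unary using (Decidable)
open +-*-Solver using (solve; _:+_; _:=_; con)
open import Algebra.Properties.CommutativeSemigroup +-commutativeSemigroup using () renaming (interchange to +-interchange)

-- χ d is 1 when the decided proposition holds and 0 otherwise; all the
-- statistics of a diagram (dinv, conjugates) are sums of such indicators.
χ : {P : Set} → Dec P → ℕ
χ (yes _) = 1
χ (no _)  = 0

χ-yes : {P : Set} (d : Dec P) → P → χ d ≡ 1
χ-yes (yes _) _ = refl
χ-yes (no ¬p) p = ⊥-elim (¬p p)

χ-no : {P : Set} (d : Dec P) → ¬ P → χ d ≡ 0
χ-no (yes p) ¬p = ⊥-elim (¬p p)
χ-no (no _)  _  = refl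

χ≤1 : {P : Set} (d : Dec P) → χ d ≤ 1
χ≤1 (yes _) = ≤-refl
χ≤1 (no _)  = z≤n

χ-cong : {P Q : Set} (d : Dec P) (e : Dec Q) → (P → Q) → (Q → P) → χ d ≡ χ e
χ-cong (yes p) (yes q) f g = refl
χ-cong (yes p) (no ¬q) f g = ⊥-elim (¬q (f p))
χ-cong (no ¬p) (yes q) f g = ⊥-elim (¬p (g q))
χ-cong (no _)  (no _)  f g = refl

range : ℕ → ℕ → List ℕ
range a zero    = []
range a (suc n) = a ∷ range (suc a) n

sumFrom : (ℕ → ℕ) → ℕ → ℕ → ℕ
sumFrom f a zero    = 0
sumFrom f a (suc n) = f a + sumFrom f (suc a) n

count-range : {P : ℕ → Set} (P? : Decidable P) (a n : ℕ) →
  length (filter P? (range a n)) ≡ sumFrom (χ ∘ P?) a n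
count-range P? a zero = refl
count-range P? a (suc n) with P? a
... | yes _ = cong suc (count-range P? (suc a) n)
... | no _  = count-range P? (suc a) n

count-∷ : {P : ℕ → Set} (P? : Decidable P) (x : ℕ) (xs : List ℕ) →
  length (filter P? (x ∷ xs)) ≡ χ (P? x) + length (filter P? xs)
count-∷ P? x xs with P? x
... | yes _ = refl
... | no _  = refl

applyUpTo-range : (f : ℕ → ℕ) (a n : ℕ) → (∀ x → f x ≡ a + x) → applyUpTo f n ≡ range a n
applyUpTo-range f a zero    hf = refl
applyUpTo-range f a (suc n) hf =
  cong₂ _∷_ (trans (hf 0) (+-identityʳ a))
            (applyUpTo-range (f ∘ suc) (suc a) n (λ x → trans (hf (suc x)) (+-suc a x)))

oneTo-range : (n : ℕ) → oneTo n ≡ range 1 n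
oneTo-range n = trans (map-applyUpTo id suc n) (applyUpTo-range suc 1 n (λ _ → refl))

sumFrom-cong : (f g : ℕ → ℕ) (a n : ℕ) → (∀ j → a ≤ j → j < a + n → f j ≡ g j) →
  sumFrom f a n ≡ sumFrom g a n
sumFrom-cong f g a zero    h = refl
sumFrom-cong f g a (suc n) h =
  cong₂ _+_ (h a ≤-refl (m<m+n a (s≤s z≤n)))
            (sumFrom-cong f g (suc a) n (λ j a<j j< → h j (<⇒≤ a<j) (subst (j <_) (sym (+-suc a n)) j<)))

sumFrom-split : (f : ℕ → ℕ) (a m n : ℕ) → sumFrom f a (m + n) ≡ sumFrom f a m + sumFrom f (m + a) n
sumFrom-split f a zero    n = refl
sumFrom-split f a (suc m) n = begin
  f a + sumFrom f (suc a) (m + n)                     ≡⟨ cong (f a +_) (sumFrom-split f (suc a) m n) ⟩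
  f a + (sumFrom f (suc a) m + sumFrom f (m + suc a) n) ≡⟨ cong (λ z → f a + (sumFrom f (suc a) m + sumFrom f z n)) (+-suc m a) ⟩
  f a + (sumFrom f (suc a) m + sumFrom f (suc m + a) n) ≡⟨ +-assoc (f a) _ _ ⟨
  f a + sumFrom f (suc a) m + sumFrom f (suc m + a) n   ∎
  where open ≡-Reasoning

sumFrom-shift : (f : ℕ → ℕ) (a n : ℕ) → sumFrom f (suc a) n ≡ sumFrom (f ∘ suc) a n
sumFrom-shift f a zero    = refl
sumFrom-shift f a (suc n) = cong (f (suc a) +_) (sumFrom-shift f (suc a) n)

sumFrom-+ : (f g : ℕ → ℕ) (a n : ℕ) → sumFrom (λ j → f j + g j) a n ≡ sumFrom f a n + sumFrom g a n
sumFrom-+ f g a zero    = refl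
sumFrom-+ f g a (suc n) =
  trans (cong (f a + g a +_) (sumFrom-+ f g (suc a) n)) (+-interchange (f a) (g a) _ _)

sumFrom-zeros : (f : ℕ → ℕ) (a n : ℕ) → (∀ j → a ≤ j → j < a + n → f j ≡ 0) → sumFrom f a n ≡ 0
sumFrom-zeros f a n h = trans (sumFrom-cong f (λ _ → 0) a n h) (zeros a n)
  where
  zeros : ∀ a n → sumFrom (λ _ → 0) a n ≡ 0
  zeros a zero    = refl
  zeros a (suc n) = zeros (suc a) n

sumFrom-ones : (f : ℕ → ℕ) (a n : ℕ) → (∀ j → a ≤ j → j < a + n → f j ≡ 1) → sumFrom f a n ≡ n
sumFrom-ones f a n h = trans (sumFrom-cong f (λ _ → 1) a n h) (ones a n)
  where
  ones : ∀ a n → sumFrom (λ _ → 1) a n ≡ n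
  ones a zero    = refl
  ones a (suc n) = cong suc (ones (suc a) n)

sumFrom-point-below : (v a n : ℕ) → v < a → sumFrom (λ j → χ (j ≟ v)) a n ≡ 0
sumFrom-point-below v a n v<a =
  sumFrom-zeros _ a n (λ j a≤j _ → χ-no (j ≟ v) (λ { refl → <⇒≱ v<a a≤j }))

sumFrom-point : (v a n : ℕ) → a ≤ v → sumFrom (λ j → χ (j ≟ v)) a n ≡ χ (v <? a + n)
sumFrom-point v a zero a≤v = sym (χ-no (v <? a + 0) (λ v< → <⇒≱ v< (≤-trans (≤-reflexive (+-identityʳ a)) a≤v)))
sumFrom-point v a (suc n) a≤v with a ≟ v
... | yes refl = trans (cong suc (sumFrom-point-below a (suc a) n ≤-refl))
                       (sym (χ-yes (a <? a + suc n) (m<m+n a (s≤s z≤n))))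
... | no a≢v   = trans (sumFrom-point v (suc a) n (≤∧≢⇒< a≤v a≢v))
                       (cong (λ z → χ (v <? z)) (sym (+-suc a n)))

Positive : List ℕ → Set
Positive = All (1 ≤_)

Descending : List ℕ → Set
Descending = AllPairs _≥_

nonzero? : Decidable (λ p → ¬ p ≡ 0)
nonzero? p = ¬? (p ≟ 0)

strip-positive : (xs : List ℕ) → Positive xs → strip xs ≡ xs
strip-positive xs pos = filter-all nonzero? (All.map (λ { (s≤s _) () }) pos)

strip-zeros : (xs : List ℕ) → All (_≤ 0) xs → strip xs ≡ []
strip-zeros xs zs = filter-none nonzero? (All.map (λ { z≤n ne → ne refl }) zs)

strip-++ : (xs ys : List ℕ) → strip (xs ++ ys) ≡ strip xs ++ strip ys
strip-++ = filter-++ nonzero?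

strip-Positive : (xs : List ℕ) → Positive (strip xs)
strip-Positive []          = []
strip-Positive (zero ∷ xs)  = strip-Positive xs
strip-Positive (suc x ∷ xs) = s≤s z≤n ∷ strip-Positive xs

strip-Descending : {xs : List ℕ} → Descending xs → Descending (strip xs)
strip-Descending = AllPairs.filter⁺ nonzero?

strip-All : {P : ℕ → Set} {xs : List ℕ} → All P xs → All P (strip xs)
strip-All = All.filter⁺ nonzero?

sum-strip : (xs : List ℕ) → sum (strip xs) ≡ sum xs
sum-strip []           = refl
sum-strip (zero ∷ xs)  = sum-strip xs
sum-strip (suc x ∷ xs) = cong (suc x +_) (sum-strip xs)

strip-dec-strip : (xs : List ℕ) → strip (map (_∸ 1) (strip xs)) ≡ strip (map (_∸ 1) xs)
strip-dec-strip []                 = refl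
strip-dec-strip (zero ∷ xs)        = strip-dec-strip xs
strip-dec-strip (suc zero ∷ xs)    = strip-dec-strip xs
strip-dec-strip (suc (suc x) ∷ xs) = cong (suc x ∷_) (strip-dec-strip xs)

dropCol : List ℕ → List ℕ
dropCol γ = strip (map (_∸ 1) γ)

conj-∷ : (p : ℕ) (γ : List ℕ) (j : ℕ) → conj (p ∷ γ) j ≡ χ (j ≤? p) + conj γ j
conj-∷ p γ j = count-∷ (j ≤?_) p γ

conj-∷-≤ : (p : ℕ) (γ : List ℕ) (j : ℕ) → j ≤ p → conj (p ∷ γ) j ≡ suc (conj γ j)
conj-∷-≤ p γ j j≤p = trans (conj-∷ p γ j) (cong (_+ conj γ j) (χ-yes (j ≤? p) j≤p))

conj-++ : (xs ys : List ℕ) (j : ℕ) → conj (xs ++ ys) j ≡ conj xs j + conj ys j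
conj-++ []       ys j = refl
conj-++ (x ∷ xs) ys j = begin
  conj (x ∷ xs ++ ys) j               ≡⟨ conj-∷ x (xs ++ ys) j ⟩
  χ (j ≤? x) + conj (xs ++ ys) j      ≡⟨ cong (χ (j ≤? x) +_) (conj-++ xs ys j) ⟩
  χ (j ≤? x) + (conj xs j + conj ys j) ≡⟨ +-assoc (χ (j ≤? x)) _ _ ⟨
  χ (j ≤? x) + conj xs j + conj ys j   ≡⟨ cong (_+ conj ys j) (conj-∷ x xs j) ⟨
  conj (x ∷ xs) j + conj ys j          ∎
  where open ≡-Reasoning

conj-beyond : (p : ℕ) (γ : List ℕ) (j : ℕ) → All (_≤ p) γ → p < j → conj γ j ≡ 0
conj-beyond p []      j _           _   = refl
conj-beyond p (x ∷ γ) j (x≤p ∷ bnd) p<j =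
  trans (conj-∷ x γ j) (cong₂ _+_ (χ-no (j ≤? x) (λ j≤x → <⇒≱ p<j (≤-trans j≤x x≤p)))
                                   (conj-beyond p γ j bnd p<j))

conj-full : (γ : List ℕ) (j : ℕ) → All (j ≤_) γ → conj γ j ≡ length γ
conj-full []      j _            = refl
conj-full (x ∷ γ) j (j≤x ∷ long) = trans (conj-∷-≤ x γ j j≤x) (cong suc (conj-full γ j long))

conj-replicate : (a x j : ℕ) → j ≤ x → conj (replicate a x) j ≡ a
conj-replicate a x j j≤x =
  trans (conj-full (replicate a x) j (All.replicate⁺ a j≤x)) (length-replicate a)

conj-strip : (xs : List ℕ) (j : ℕ) → conj (strip xs) (suc j) ≡ conj xs (suc j)
conj-strip []           j = refl
conj-strip (zero ∷ xs)  j = conj-strip xs j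
conj-strip (suc x ∷ xs) j = begin
  conj (suc x ∷ strip xs) (suc j)          ≡⟨ conj-∷ (suc x) (strip xs) (suc j) ⟩
  χ (suc j ≤? suc x) + conj (strip xs) (suc j) ≡⟨ cong (χ (suc j ≤? suc x) +_) (conj-strip xs j) ⟩
  χ (suc j ≤? suc x) + conj xs (suc j)     ≡⟨ conj-∷ (suc x) xs (suc j) ⟨
  conj (suc x ∷ xs) (suc j)                ∎
  where open ≡-Reasoning

conj-dec : (xs : List ℕ) (j : ℕ) → conj (map (_∸ 1) xs) (suc j) ≡ conj xs (suc (suc j))
conj-dec []       j = refl
conj-dec (x ∷ xs) j =
  trans (conj-∷ (x ∸ 1) (map (_∸ 1) xs) (suc j))
        (trans (cong₂ _+_ (χ-cong (suc j ≤? x ∸ 1) (suc (suc j) ≤? x) (fwd x) (bwd x)) (conj-dec xs j))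
               (sym (conj-∷ x xs (suc (suc j)))))
  where
  fwd : ∀ x → suc j ≤ x ∸ 1 → suc (suc j) ≤ x
  fwd (suc x) h = s≤s h
  bwd : ∀ x → suc (suc j) ≤ x → suc j ≤ x ∸ 1
  bwd (suc x) (s≤s h) = h

conj-dropCol : (γ : List ℕ) (j : ℕ) → conj (dropCol γ) (suc j) ≡ conj γ (suc (suc j))
conj-dropCol γ j = trans (conj-strip (map (_∸ 1) γ) j) (conj-dec γ j)

dinvCell : ℕ → ℕ → ℕ
dinvCell a l = χ ((a ≟ l) ⊎-dec (a ≟ suc l))

dinvCell-split : (a l : ℕ) → dinvCell a l ≡ χ (a ≟ l) + χ (a ≟ suc l)
dinvCell-split a l with a ≟ l | a ≟ suc l
... | yes p | yes q = ⊥-elim (1+n≢n (trans (sym q) p))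
... | yes _ | no _  = refl
... | no _  | yes _ = refl
... | no _  | no _  = refl

dinvCell-one : (l b a : ℕ) → b ≤ 1 → l + b ≡ a → dinvCell a l ≡ 1
dinvCell-one l zero          a _ e = χ-yes ((a ≟ l) ⊎-dec (a ≟ suc l)) (inj₁ (trans (sym e) (+-identityʳ l)))
dinvCell-one l (suc zero)    a _ e = χ-yes ((a ≟ l) ⊎-dec (a ≟ suc l)) (inj₂ (trans (sym e) (+-comm l 1)))
dinvCell-one l (suc (suc b)) a (s≤s ()) e

dinvCell-zero : (a l : ℕ) → a < l → dinvCell a l ≡ 0
dinvCell-zero a l a<l = χ-no ((a ≟ l) ⊎-dec (a ≟ suc l)) λ
  { (inj₁ e) → <⇒≢ a<l e
  ; (inj₂ e) → <⇒≢ (≤-trans a<l (n≤1+n l)) e }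

rowsFrom : ℕ → List ℕ → List (ℕ × ℕ)
rowsFrom i []       = []
rowsFrom i (p ∷ ps) = (i , p) ∷ rowsFrom (suc i) ps

rows-rowsFrom : (γ : List ℕ) → rows γ ≡ rowsFrom 1 γ
rows-rowsFrom γ = trans (cong (λ is → zip is γ) (oneTo-range (length γ))) (zipRange 1 γ)
  where
  zipRange : ∀ i xs → zip (range i (length xs)) xs ≡ rowsFrom i xs
  zipRange i []       = refl
  zipRange i (x ∷ xs) = cong ((i , x) ∷_) (zipRange (suc i) xs)

dinvFrom : List ℕ → ℕ → List ℕ → ℕ
dinvFrom g i xs = dinvAux g (rowsFrom i xs)

dinv-dinvFrom : (γ : List ℕ) → dinv γ ≡ dinvFrom γ 1 γ
dinv-dinvFrom γ = cong (dinvAux γ) (rows-rowsFrom γ)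

dinvRow-sum : (γ : List ℕ) (i p : ℕ) → dinvRow γ i p ≡ sumFrom (λ j → dinvCell (p ∸ j) (conj γ j ∸ i)) 1 p
dinvRow-sum γ i p = trans (cong (length ∘ filter cell?) (oneTo-range p)) (count-range cell? 1 p)
  where
  cell? = λ j → ((p ∸ j) ≟ (conj γ j ∸ i)) ⊎-dec ((p ∸ j) ≟ suc (conj γ j ∸ i))

-- Adding a row x on top of shorter rows raises every leg below it by one,
-- so their contributions are unchanged when renumbered.
dinvFrom-below : (x : ℕ) (γ : List ℕ) (i : ℕ) (ys : List ℕ) → All (_≤ x) ys →
  dinvFrom (x ∷ γ) (suc i) ys ≡ dinvFrom γ i ys
dinvFrom-below x γ i []       _           = refl
dinvFrom-below x γ i (p ∷ ps) (p≤x ∷ bnd) = cong₂ _+_ row (dinvFrom-below x γ (suc i) ps bnd)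
  where
  row : dinvRow (x ∷ γ) (suc i) p ≡ dinvRow γ i p
  row = trans (dinvRow-sum (x ∷ γ) (suc i) p)
         (trans (sumFrom-cong _ _ 1 p (λ j _ j< →
                   cong (λ c → dinvCell (p ∸ j) (c ∸ suc i)) (conj-∷-≤ x γ j (≤-trans (≤-pred j<) p≤x))))
                (sym (dinvRow-sum γ i p)))

dinv-prepend : (x : ℕ) (γ : List ℕ) → All (_≤ x) γ →
  dinv (x ∷ γ) ≡ sumFrom (λ j → dinvCell (x ∸ j) (conj γ j)) 1 x + dinv γ
dinv-prepend x γ bnd = begin
  dinv (x ∷ γ)                               ≡⟨ dinv-dinvFrom (x ∷ γ) ⟩
  dinvRow (x ∷ γ) 1 x + dinvFrom (x ∷ γ) 2 γ ≡⟨ cong₂ _+_ row (dinvFrom-below x γ 1 γ bnd) ⟩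
  topRow + dinvFrom γ 1 γ                    ≡⟨ cong (topRow +_) (dinv-dinvFrom γ) ⟨
  topRow + dinv γ                            ∎
  where
  open ≡-Reasoning
  topRow = sumFrom (λ j → dinvCell (x ∸ j) (conj γ j)) 1 x
  row : dinvRow (x ∷ γ) 1 x ≡ topRow
  row = trans (dinvRow-sum (x ∷ γ) 1 x)
          (sumFrom-cong _ _ 1 x (λ j _ j< → cong (λ c → dinvCell (x ∸ j) (c ∸ 1)) (conj-∷-≤ x γ j (≤-pred j<))))

-- firstColDinv L i xs counts the first-column cells of the rows xs (numbered
-- from i, in a partition with L rows) that count for dinv: such a cell has
-- arm p - 1 and leg L - i.
firstColDinv : ℕ → ℕ → List ℕ → ℕ
firstColDinv L i []       = 0
firstColDinv L i (p ∷ ps) = dinvCell (p ∸ 1) (L ∸ i) + firstColDinv L (suc i) ps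

dinvFrom-dropCol : (γ : List ℕ) (i : ℕ) (xs : List ℕ) → Positive xs →
  dinvFrom γ i xs ≡ dinvFrom (dropCol γ) i (map (_∸ 1) xs) + firstColDinv (conj γ 1) i xs
dinvFrom-dropCol γ i []           _         = refl
dinvFrom-dropCol γ i (suc p ∷ ps) (_ ∷ pos) = begin
  dinvRow γ i (suc p) + dinvFrom γ (suc i) ps
    ≡⟨ cong₂ _+_ row (dinvFrom-dropCol γ (suc i) ps pos) ⟩
  (c + dinvRow (dropCol γ) i p) + (dinvFrom (dropCol γ) (suc i) (map (_∸ 1) ps) + F)
    ≡⟨ regroup c (dinvRow (dropCol γ) i p) _ F ⟩
  (dinvRow (dropCol γ) i p + dinvFrom (dropCol γ) (suc i) (map (_∸ 1) ps)) + (c + F) ∎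
  where
  open ≡-Reasoning
  c = dinvCell p (conj γ 1 ∸ i)
  F = firstColDinv (conj γ 1) (suc i) ps
  regroup : ∀ a b x y → (a + b) + (x + y) ≡ (b + x) + (a + y)
  regroup = solve 4 (λ a b x y → (a :+ b) :+ (x :+ y) := (b :+ x) :+ (a :+ y)) refl
  f : ℕ → ℕ
  f j = dinvCell (suc p ∸ j) (conj γ j ∸ i)
  row : dinvRow γ i (suc p) ≡ c + dinvRow (dropCol γ) i p
  row = trans (dinvRow-sum γ i (suc p)) (cong (c +_)
         (trans (sumFrom-shift f 1 p)
          (trans (sumFrom-cong (f ∘ suc) _ 1 p
                   (λ { (suc j) _ _ → cong (λ c → dinvCell (p ∸ suc j) (c ∸ i)) (sym (conj-dropCol γ j)) }))
                 (sym (dinvRow-sum (dropCol γ) i p)))))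

dinvFrom-strip : (g : List ℕ) (i : ℕ) (xs : List ℕ) → Descending xs → dinvFrom g i (strip xs) ≡ dinvFrom g i xs
dinvFrom-strip g i []           _           = refl
dinvFrom-strip g i (zero ∷ xs)  (zs ∷ _)    = trans (cong (dinvFrom g i) (strip-zeros xs zs)) (sym (zeroRows (suc i) xs zs))
  where
  zeroRows : ∀ i xs → All (_≤ 0) xs → dinvFrom g i xs ≡ 0
  zeroRows i []          _        = refl
  zeroRows i (zero ∷ xs) (_ ∷ zs) = zeroRows (suc i) xs zs
dinvFrom-strip g i (suc x ∷ xs) (_ ∷ desc) = cong (dinvRow g i (suc x) +_) (dinvFrom-strip g (suc i) xs desc)

dec-Descending : {xs : List ℕ} → Descending xs → Descending (map (_∸ 1) xs)
dec-Descending desc = AllPairs.map⁺ (AllPairs.map (∸-monoˡ-≤ 1) desc)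

dinv-dropCol : (γ : List ℕ) → Descending γ → Positive γ →
  dinv γ ≡ dinv (dropCol γ) + firstColDinv (length γ) 1 γ
dinv-dropCol γ desc pos = begin
  dinv γ ≡⟨ dinv-dinvFrom γ ⟩
  dinvFrom γ 1 γ ≡⟨ dinvFrom-dropCol γ 1 γ pos ⟩
  dinvFrom (dropCol γ) 1 (map (_∸ 1) γ) + firstColDinv (conj γ 1) 1 γ
    ≡⟨ cong₂ _+_ (sym (dinvFrom-strip (dropCol γ) 1 (map (_∸ 1) γ) (dec-Descending desc)))
                 (cong (λ L → firstColDinv L 1 γ) (conj-full γ 1 pos)) ⟩
  dinvFrom (dropCol γ) 1 (dropCol γ) + firstColDinv (length γ) 1 γ
    ≡⟨ cong (_+ firstColDinv (length γ) 1 γ) (dinv-dinvFrom (dropCol γ)) ⟨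
  dinv (dropCol γ) + firstColDinv (length γ) 1 γ ∎
  where open ≡-Reasoning

-- rowsOnDiag i v xs counts the rows (numbered from i) whose last cell lies
-- on the anti-diagonal v, i.e. with part + row index = v.
rowsOnDiag : ℕ → ℕ → List ℕ → ℕ
rowsOnDiag i v []       = 0
rowsOnDiag i v (p ∷ ps) = χ (p + i ≟ v) + rowsOnDiag (suc i) v ps

rowsOnDiag-shift : (i v : ℕ) (xs : List ℕ) → rowsOnDiag (suc i) (suc v) xs ≡ rowsOnDiag i v xs
rowsOnDiag-shift i v []       = refl
rowsOnDiag-shift i v (p ∷ ps) =
  cong₂ _+_ (χ-cong (p + suc i ≟ suc v) (p + i ≟ v)
                    (λ e → suc-injective (trans (sym (+-suc p i)) e))
                    (λ e → trans (+-suc p i) (cong suc e)))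
            (rowsOnDiag-shift (suc i) v ps)

-- colOnDiag γ v j is 1 when the last cell of column j lies on the
-- anti-diagonal v.
colOnDiag : List ℕ → ℕ → ℕ → ℕ
colOnDiag γ v j = χ (j + conj γ j ≟ v)

χ-<-end : (p M y : ℕ) → p ≤ M → χ (y <? p + 1 + (M ∸ p)) ≡ χ (y ≤? M)
χ-<-end p M y p≤M = χ-cong _ _ (λ lt → ≤-pred (subst (y <_) end lt)) (λ le → subst (y <_) (sym end) (s≤s le))
  where
  end : p + 1 + (M ∸ p) ≡ suc M
  end = trans (cong (_+ (M ∸ p)) (+-comm p 1)) (cong suc (m+[n∸m]≡n p≤M))

-- Bookkeeping for one new top row p in the crossing identity below: the
-- columns p+1, …, M (of height zero) and the new row trade places.
crossing-step : (c x p M : ℕ) → p ≤ M →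
  c + χ (x ≤? p) + sumFrom (λ j → χ (j ≟ suc x)) (p + 1) (M ∸ p)
    ≡ χ (p + 1 ≟ suc x) + c + χ (suc x ≤? M)
crossing-step c x p M p≤M with <-cmp x p
... | tri< x<p _ _
  rewrite χ-yes (x ≤? p) (<⇒≤ x<p)
        | sumFrom-point-below (suc x) (p + 1) (M ∸ p) (subst (suc x <_) (+-comm 1 p) (s≤s x<p))
        | χ-no (p + 1 ≟ suc x) (λ e → <⇒≢ x<p (suc-injective (trans (sym e) (+-comm p 1))))
        | χ-yes (suc x ≤? M) (≤-trans x<p p≤M)
  = +-identityʳ (c + 1)
... | tri≈ _ refl _
  rewrite χ-yes (x ≤? x) ≤-refl
        | sumFrom-point (suc x) (x + 1) (M ∸ x) (≤-reflexive (+-comm x 1))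
        | χ-<-end x M (suc x) p≤M
        | χ-yes (x + 1 ≟ suc x) (+-comm x 1)
  = cong (_+ χ (suc x ≤? M)) (+-comm c 1)
... | tri> _ _ x>p
  rewrite χ-no (x ≤? p) (<⇒≱ x>p)
        | sumFrom-point (suc x) (p + 1) (M ∸ p) (subst (_≤ suc x) (+-comm 1 p) (s≤s (<⇒≤ x>p)))
        | χ-<-end p M (suc x) p≤M
        | χ-no (p + 1 ≟ suc x) (λ e → <⇒≢ x>p (suc-injective (trans (sym (+-comm p 1)) e)))
  = cong (_+ χ (suc x ≤? M)) (+-identityʳ c)

-- The crossing identity: the boundary of the diagram of γ (inside an
-- (M × ∞) box) meets the anti-diagonal v = ℓ(γ) + d exactly once, either at
-- the end of a column or at the end of a row; the last term accounts for
-- the boundary leaving the box.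
diagonal-crossing : (γ : List ℕ) (d M : ℕ) → 1 ≤ d → Descending γ → All (_≤ M) γ →
  sumFrom (colOnDiag γ (length γ + d)) 1 M ≡ rowsOnDiag 1 (length γ + d) γ + χ (length γ + d ≤? M)
diagonal-crossing [] d M 1≤d _ _ =
  trans (sumFrom-cong _ (λ j → χ (j ≟ d)) 1 M (λ j _ _ → cong (λ z → χ (z ≟ d)) (+-identityʳ j)))
        (trans (sumFrom-point d 1 M 1≤d) (χ-cong _ _ ≤-pred s≤s))
diagonal-crossing (p ∷ γ) d M 1≤d (bnd ∷ desc) (p≤M ∷ _) = begin
  sumFrom f 1 M                             ≡⟨ cong (sumFrom f 1) (m+[n∸m]≡n p≤M) ⟨
  sumFrom f 1 (p + (M ∸ p))                 ≡⟨ sumFrom-split f 1 p (M ∸ p) ⟩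
  sumFrom f 1 p + sumFrom f (p + 1) (M ∸ p) ≡⟨ cong₂ _+_ shortCols emptyCols ⟩
  rowsOnDiag 1 v γ + χ (v ≤? p) + sumFrom (λ j → χ (j ≟ suc v)) (p + 1) (M ∸ p)
    ≡⟨ crossing-step (rowsOnDiag 1 v γ) v p M p≤M ⟩
  χ (p + 1 ≟ suc v) + rowsOnDiag 1 v γ + χ (suc v ≤? M)
    ≡⟨ cong (λ z → χ (p + 1 ≟ suc v) + z + χ (suc v ≤? M)) (rowsOnDiag-shift 1 v γ) ⟨
  rowsOnDiag 1 (suc v) (p ∷ γ) + χ (suc v ≤? M) ∎
  where
  open ≡-Reasoning
  v = length γ + d
  f = colOnDiag (p ∷ γ) (suc v)
  -- columns 1..p get one more cell from the new row
  shortCols : sumFrom f 1 p ≡ rowsOnDiag 1 v γ + χ (v ≤? p)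
  shortCols = trans (sumFrom-cong f (colOnDiag γ v) 1 p (λ j _ j< → χ-cong _ _
                (λ e → suc-injective (trans (sym (+-suc j (conj γ j))) (trans (cong (j +_) (sym (conj-∷-≤ p γ j (≤-pred j<)))) e)))
                (λ e → trans (cong (j +_) (conj-∷-≤ p γ j (≤-pred j<))) (trans (+-suc j (conj γ j)) (cong suc e)))))
              (diagonal-crossing γ d p 1≤d desc bnd)
  -- columns beyond p are empty
  emptyCols : sumFrom f (p + 1) (M ∸ p) ≡ sumFrom (λ j → χ (j ≟ suc v)) (p + 1) (M ∸ p)
  emptyCols = sumFrom-cong f _ (p + 1) (M ∸ p) (λ j p< _ → cong (λ z → χ (z ≟ suc v))
    (trans (cong (j +_) (conj-beyond p (p ∷ γ) j (≤-refl ∷ bnd) (subst (_≤ j) (+-comm p 1) p<))) (+-identityʳ j)))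

-- A first-column cell of row i (of length p+1) in a partition with L rows has
-- arm p and leg L - i; it counts for dinv iff the row ends on the
-- anti-diagonal L+1 or L+2.
firstColCell : (L i p : ℕ) → i ≤ L →
  dinvCell p (L ∸ i) ≡ χ (suc p + i ≟ L + 1) + χ (suc p + i ≟ L + 2)
firstColCell L i p i≤L = trans (dinvCell-split p (L ∸ i)) (cong₂ _+_
  (χ-cong (p ≟ L ∸ i) (suc p + i ≟ L + 1)
          (λ e → trans (cong suc (trans (cong (_+ i) e) (m∸n+n≡m i≤L))) (sym (+-comm L 1)))
          (λ e → sym (trans (cong (_∸ i) (sym (suc-injective (trans e (+-comm L 1))))) (m+n∸n≡m p i))))
  (χ-cong (p ≟ suc (L ∸ i)) (suc p + i ≟ L + 2)
          (λ e → trans (cong suc (trans (cong (_+ i) e) (cong suc (m∸n+n≡m i≤L)))) (sym (+-comm L 2)))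
          (λ e → sym (trans (sym (+-∸-assoc 1 i≤L))
                     (trans (cong (_∸ i) (sym (suc-injective (trans e (+-comm L 2))))) (m+n∸n≡m p i))))))

firstColDinv-diagonals : (L i : ℕ) (xs : List ℕ) → Positive xs → i + length xs ≤ suc L →
  firstColDinv L i xs ≡ rowsOnDiag i (L + 1) xs + rowsOnDiag i (L + 2) xs
firstColDinv-diagonals L i []           _         _ = refl
firstColDinv-diagonals L i (suc p ∷ ps) (_ ∷ pos) h = begin
  dinvCell p (L ∸ i) + firstColDinv L (suc i) ps
    ≡⟨ cong₂ _+_ (firstColCell L i p i≤L) (firstColDinv-diagonals L (suc i) ps pos h′) ⟩
  (on₁ + on₂) + (rowsOnDiag (suc i) (L + 1) ps + rowsOnDiag (suc i) (L + 2) ps)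
    ≡⟨ +-interchange on₁ on₂ (rowsOnDiag (suc i) (L + 1) ps) (rowsOnDiag (suc i) (L + 2) ps) ⟩
  (on₁ + rowsOnDiag (suc i) (L + 1) ps) + (on₂ + rowsOnDiag (suc i) (L + 2) ps) ∎
  where
  open ≡-Reasoning
  on₁ = χ (suc p + i ≟ L + 1)
  on₂ = χ (suc p + i ≟ L + 2)
  h′ : suc i + length ps ≤ suc L
  h′ = subst (_≤ suc L) (+-suc i (length ps)) h
  i≤L : i ≤ L
  i≤L = ≤-pred (≤-trans (s≤s (m≤m+n i (length ps))) h′)

newRowCell : (L j c : ℕ) → j ≤ L →
  dinvCell (suc L ∸ suc j) c ≡ χ (suc (suc j) + c ≟ L + 2) + χ (suc (suc j) + c ≟ L + 1)
newRowCell L j c j≤L = trans (dinvCell-split (L ∸ j) c) (cong₂ _+_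
  (χ-cong (L ∸ j ≟ c) (suc (suc j) + c ≟ L + 2)
          (λ e → trans (cong (suc ∘ suc) (arm e)) (sym (+-comm L 2)))
          (λ e → unarm (suc-injective (suc-injective (trans e (+-comm L 2))))))
  (χ-cong (L ∸ j ≟ suc c) (suc (suc j) + c ≟ L + 1)
          (λ e → trans (cong suc (trans (sym (+-suc j c)) (arm e))) (sym (+-comm L 1)))
          (λ e → unarm (trans (+-suc j c) (suc-injective (trans e (+-comm L 1)))))))
  where
  arm : ∀ {c} → L ∸ j ≡ c → j + c ≡ L
  arm refl = m+[n∸m]≡n j≤L
  unarm : ∀ {c} → j + c ≡ L → L ∸ j ≡ c
  unarm {c} refl = m+n∸m≡n j c

-- Crossing identity for a partition with L rows and parts at most L+2, at
-- the anti-diagonals L+2 and L+1, summed over the columns 2, …, L+2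
-- (column 1 has height L, so it ends on the diagonal L+1).
crossings-at-L+2 : (γ : List ℕ) → Descending γ → Positive γ → All (_≤ 2 + length γ) γ →
  sumFrom (colOnDiag γ (length γ + 2)) 2 (suc (length γ)) ≡ rowsOnDiag 1 (length γ + 2) γ + 1
crossings-at-L+2 γ desc pos bnd = begin
  sumFrom g 2 (suc L)                ≡⟨ cong (_+ sumFrom g 2 (suc L)) firstCol ⟨
  g 1 + sumFrom g 2 (suc L)          ≡⟨ diagonal-crossing γ 2 (2 + L) (s≤s z≤n) desc bnd ⟩
  rowsOnDiag 1 (L + 2) γ + χ (L + 2 ≤? 2 + L) ≡⟨ cong (rowsOnDiag 1 (L + 2) γ +_) (χ-yes (L + 2 ≤? 2 + L) (≤-reflexive (+-comm L 2))) ⟩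
  rowsOnDiag 1 (L + 2) γ + 1         ∎
  where
  open ≡-Reasoning
  L = length γ
  g = colOnDiag γ (L + 2)
  firstCol : g 1 ≡ 0
  firstCol = χ-no (1 + conj γ 1 ≟ L + 2)
    (λ e → 1+n≢n (sym (suc-injective (trans (sym (cong suc (conj-full γ 1 pos))) (trans e (+-comm L 2))))))

crossings-at-L+1 : (γ : List ℕ) → Descending γ → Positive γ → All (_≤ 2 + length γ) γ →
  sumFrom (colOnDiag γ (length γ + 1)) 2 (suc (length γ)) ≡ rowsOnDiag 1 (length γ + 1) γ
crossings-at-L+1 γ desc pos bnd = +-cancelˡ-≡ 1 _ _ (begin
  1 + sumFrom h 2 (suc L)                      ≡⟨ cong (_+ sumFrom h 2 (suc L)) firstCol ⟨
  h 1 + sumFrom h 2 (suc L)                    ≡⟨ diagonal-crossing γ 1 (2 + L) (s≤s z≤n) desc bnd ⟩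
  rowsOnDiag 1 (L + 1) γ + χ (L + 1 ≤? 2 + L)  ≡⟨ cong (rowsOnDiag 1 (L + 1) γ +_) (χ-yes (L + 1 ≤? 2 + L) (≤-trans (≤-reflexive (+-comm L 1)) (n≤1+n _))) ⟩
  rowsOnDiag 1 (L + 1) γ + 1                   ≡⟨ +-comm _ 1 ⟩
  1 + rowsOnDiag 1 (L + 1) γ                   ∎)
  where
  open ≡-Reasoning
  L = length γ
  h = colOnDiag γ (L + 1)
  firstCol : h 1 ≡ 1
  firstCol = χ-yes (1 + conj γ 1 ≟ L + 1) (trans (cong suc (conj-full γ 1 pos)) (+-comm 1 L))

newRow-dinv : (γ : List ℕ) → Descending γ → Positive γ → All (_≤ 2 + length γ) γ →
  sumFrom (λ j → dinvCell (suc (length γ) ∸ j) (conj (dropCol γ) j)) 1 (suc (length γ))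
    ≡ suc (firstColDinv (length γ) 1 γ)
newRow-dinv γ desc pos bnd = begin
  sumFrom (λ j → dinvCell (suc L ∸ j) (conj (dropCol γ) j)) 1 (suc L)
    ≡⟨ sumFrom-cong _ (λ j → g (suc j) + h (suc j)) 1 (suc L)
         (λ { (suc j) _ j< → trans (cong (dinvCell (suc L ∸ suc j)) (conj-dropCol γ j))
                                   (newRowCell L j _ (≤-pred (≤-pred j<))) }) ⟩
  sumFrom (λ j → g (suc j) + h (suc j)) 1 (suc L)
    ≡⟨ sumFrom-+ (g ∘ suc) (h ∘ suc) 1 (suc L) ⟩
  sumFrom (g ∘ suc) 1 (suc L) + sumFrom (h ∘ suc) 1 (suc L)
    ≡⟨ cong₂ _+_ (sumFrom-shift g 1 (suc L)) (sumFrom-shift h 1 (suc L)) ⟨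
  sumFrom g 2 (suc L) + sumFrom h 2 (suc L)
    ≡⟨ cong₂ _+_ (crossings-at-L+2 γ desc pos bnd) (crossings-at-L+1 γ desc pos bnd) ⟩
  rowsOnDiag 1 (L + 2) γ + 1 + rowsOnDiag 1 (L + 1) γ
    ≡⟨ rearrange (rowsOnDiag 1 (L + 2) γ) (rowsOnDiag 1 (L + 1) γ) ⟩
  suc (rowsOnDiag 1 (L + 1) γ + rowsOnDiag 1 (L + 2) γ)
    ≡⟨ cong suc (firstColDinv-diagonals L 1 γ pos ≤-refl) ⟨
  suc (firstColDinv L 1 γ) ∎
  where
  open ≡-Reasoning
  rearrange : ∀ a b → a + 1 + b ≡ suc (b + a)
  rearrange = solve 2 (λ a b → a :+ con 1 :+ b := con 1 :+ (b :+ a)) refl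
  L = length γ
  g = colOnDiag γ (L + 2)
  h = colOnDiag γ (L + 1)

νStep : List ℕ → List ℕ
νStep γ = suc (length γ) ∷ dropCol γ

len-positive : (γ : List ℕ) → Positive γ → len γ ≡ length γ
len-positive γ pos = cong length (strip-positive γ pos)

ν-νStep : (γ : List ℕ) → Positive γ → first γ ≤ length γ + 2 → ν γ ≡ just (νStep γ)
ν-νStep γ pos defined with first γ ≤? len γ + 2
... | yes _ = cong just (cong₂ _∷_ (cong suc (len-positive γ pos))
                                    (cong (λ l → strip (map (_∸ 1) l)) (strip-positive γ pos)))
... | no undefined = ⊥-elim (undefined (subst (λ z → first γ ≤ z + 2) (sym (len-positive γ pos)) defined))

parts-≤-first : (γ : List ℕ) → Descending γ → All (_≤ first γ) γ
parts-≤-first []      _          = []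
parts-≤-first (p ∷ γ) (bnd ∷ _)  = ≤-refl ∷ bnd

-- Where ν is defined, all parts are at most ℓ(γ) + 2, so the rows of
-- dropCol γ fit under the new first row ℓ(γ) + 1.
bounded-if-defined : (γ : List ℕ) → Descending γ → first γ ≤ length γ + 2 → All (_≤ 2 + length γ) γ
bounded-if-defined γ desc defined =
  All.map (λ p≤ → ≤-trans p≤ (≤-trans defined (≤-reflexive (+-comm (length γ) 2)))) (parts-≤-first γ desc)

dropCol-bounded : {M : ℕ} (γ : List ℕ) → All (_≤ suc M) γ → All (_≤ M) (dropCol γ)
dropCol-bounded γ bnd = strip-All (All.map⁺ (All.map (∸-monoˡ-≤ 1) bnd))

dinv-νStep : (γ : List ℕ) → Descending γ → Positive γ → first γ ≤ length γ + 2 →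
  dinv (νStep γ) ≡ suc (dinv γ)
dinv-νStep γ desc pos defined = begin
  dinv (νStep γ)
    ≡⟨ dinv-prepend (suc (length γ)) (dropCol γ) (dropCol-bounded γ bnd) ⟩
  sumFrom (λ j → dinvCell (suc (length γ) ∸ j) (conj (dropCol γ) j)) 1 (suc (length γ)) + dinv (dropCol γ)
    ≡⟨ cong (_+ dinv (dropCol γ)) (newRow-dinv γ desc pos bnd) ⟩
  suc (firstColDinv (length γ) 1 γ + dinv (dropCol γ))
    ≡⟨ cong suc (+-comm (firstColDinv (length γ) 1 γ) (dinv (dropCol γ))) ⟩
  suc (dinv (dropCol γ) + firstColDinv (length γ) 1 γ)
    ≡⟨ cong suc (dinv-dropCol γ desc pos) ⟨
  suc (dinv γ) ∎
  where
  open ≡-Reasoning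
  bnd = bounded-if-defined γ desc defined

-- ν raises the size by one: it removes ℓ(γ) cells and adds ℓ(γ) + 1.
size-νStep : (γ : List ℕ) → Positive γ → size (νStep γ) ≡ suc (size γ)
size-νStep γ pos = cong suc (trans (cong (length γ +_) (sum-strip (map (_∸ 1) γ))) (shorten γ pos))
  where
  shorten : ∀ xs → Positive xs → length xs + sum (map (_∸ 1) xs) ≡ sum xs
  shorten []           _         = refl
  shorten (suc x ∷ xs) (_ ∷ pos) = cong suc (begin
    length xs + (x + sum (map (_∸ 1) xs)) ≡⟨ +-assoc (length xs) x _ ⟨
    length xs + x + sum (map (_∸ 1) xs)   ≡⟨ cong (_+ sum (map (_∸ 1) xs)) (+-comm (length xs) x) ⟩
    x + length xs + sum (map (_∸ 1) xs)   ≡⟨ +-assoc x (length xs) _ ⟩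
    x + (length xs + sum (map (_∸ 1) xs)) ≡⟨ cong (x +_) (shorten xs pos) ⟩
    x + sum xs                            ∎)
    where open ≡-Reasoning

Descending-νStep : (γ : List ℕ) → Descending γ → first γ ≤ length γ + 2 → Descending (νStep γ)
Descending-νStep γ desc defined =
  dropCol-bounded γ (bounded-if-defined γ desc defined) ∷ strip-Descending (dec-Descending desc)

-- diagonals i γ lists γ_t + t for the rows t = i, i+1, …: row t ends on the
-- anti-diagonal γ_t + t.  A partition lies in the staircase of order n iff
-- all of these are at most n, so Δ(γ) is their maximum.
diagonals : ℕ → List ℕ → List ℕ
diagonals i []       = []
diagonals i (p ∷ ps) = (p + i) ∷ diagonals (suc i) ps

diagonals-++ : (i : ℕ) (xs ys : List ℕ) → diagonals i (xs ++ ys) ≡ diagonals i xs ++ diagonals (length xs + i) ys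
diagonals-++ i []       ys = refl
diagonals-++ i (x ∷ xs) ys =
  cong ((x + i) ∷_) (trans (diagonals-++ (suc i) xs ys) (cong (λ z → diagonals (suc i) xs ++ diagonals z ys) (+-suc (length xs) i)))

diagonals-dec : (i : ℕ) (xs : List ℕ) → Positive xs → diagonals (suc i) (map (_∸ 1) xs) ≡ diagonals i xs
diagonals-dec i []           _         = refl
diagonals-dec i (suc x ∷ xs) (_ ∷ pos) = cong₂ _∷_ (+-suc x i) (diagonals-dec (suc i) xs pos)

DP-rows⇒diagonals : {Q : ℕ × ℕ → Set} (n : ℕ) → (∀ i p → 1 ≤ p → Q (i , p) → p + i ≤ n) →
  (i : ℕ) (xs : List ℕ) → Positive xs → All Q (rowsFrom i xs) → All (_≤ n) (diagonals i xs)
DP-rows⇒diagonals n f i []       _          _        = []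
DP-rows⇒diagonals n f i (x ∷ xs) (px ∷ pos) (q ∷ qs) = f i x px q ∷ DP-rows⇒diagonals n f (suc i) xs pos qs

diagonals⇒DP-rows : {Q : ℕ × ℕ → Set} (n : ℕ) → (∀ i p → p + i ≤ n → Q (i , p)) →
  (i : ℕ) (xs : List ℕ) → All (_≤ n) (diagonals i xs) → All Q (rowsFrom i xs)
diagonals⇒DP-rows n f i []       _        = []
diagonals⇒DP-rows n f i (x ∷ xs) (q ∷ qs) = f i x q ∷ diagonals⇒DP-rows n f (suc i) xs qs

DP⇒diagonals : (n : ℕ) (γ : List ℕ) → Positive γ → DP n γ → All (_≤ n) (diagonals 1 γ)
DP⇒diagonals n γ pos dp = DP-rows⇒diagonals n fits 1 γ pos (subst (All _) (rows-rowsFrom γ) dp)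
  where
  -- a nonempty row fits below the staircase only if i ≤ n
  fits : ∀ i p → 1 ≤ p → p ≤ n ∸ i → p + i ≤ n
  fits i p 1≤p p≤ = ≤-trans (+-monoˡ-≤ i p≤) (≤-reflexive (m∸n+n≡m {n} {i}
    (<⇒≤ (m∸n≢0⇒n<m {n} {i} (λ e → <⇒≱ 1≤p (≤-trans p≤ (≤-reflexive e)))))))

diagonals⇒DP : (n : ℕ) (γ : List ℕ) → All (_≤ n) (diagonals 1 γ) → DP n γ
diagonals⇒DP n γ bnd =
  subst (All _) (sym (rows-rowsFrom γ)) (diagonals⇒DP-rows n (λ i p le → m+n≤o⇒m≤o∸n p le) 1 γ bnd)

Δ-from-diagonals : (γ : List ℕ) (D : ℕ) → Positive γ →
  All (_≤ D) (diagonals 1 γ) → Any (D ≤_) (diagonals 1 γ) → IsΔ γ D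
Δ-from-diagonals γ D pos bnd attained =
  diagonals⇒DP D γ bnd ,
  λ m dp → All.lookupWith (λ x≤m D≤x → ≤-trans D≤x x≤m) (DP⇒diagonals m γ pos dp) attained

residue : List ℕ → ℕ → List ℕ
residue I m = strip (map (_∸ m) I)

residue-0 : (I : List ℕ) → Positive I → residue I 0 ≡ I
residue-0 I pos = trans (cong strip (map-id I)) (strip-positive I pos)

length-residue : (xs : List ℕ) (m : ℕ) → length (residue xs m) ≡ conj xs (suc m)
length-residue []       m = refl
length-residue (x ∷ xs) m with suc m ≤? x
... | yes m<x = begin
  length (strip (x ∸ m ∷ map (_∸ m) xs)) ≡⟨ cong length (filter-accept nonzero? (m>n⇒m∸n≢0 m<x)) ⟩
  suc (length (residue xs m))            ≡⟨ cong suc (length-residue xs m) ⟩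
  suc (conj xs (suc m))                  ≡⟨ conj-∷-≤ x xs (suc m) m<x ⟨
  conj (x ∷ xs) (suc m)                  ∎
  where open ≡-Reasoning
... | no x≤m rewrite m≤n⇒m∸n≡0 (≤-pred (≰⇒> x≤m)) =
  trans (length-residue xs m) (sym (trans (conj-∷ x xs (suc m)) (cong (_+ conj xs (suc m)) (χ-no (suc m ≤? x) x≤m))))

dropCol-residue : (I : List ℕ) (m : ℕ) → dropCol (residue I m) ≡ residue I (suc m)
dropCol-residue I m = trans (strip-dec-strip (map (_∸ m) I)) (cong strip (dec-map I))
  where
  dec-map : ∀ xs → map (_∸ 1) (map (_∸ m) xs) ≡ map (_∸ suc m) xs
  dec-map []       = refl
  dec-map (x ∷ xs) = cong₂ _∷_ (trans (∸-+-assoc x m 1) (cong (x ∸_) (+-comm m 1))) (dec-map xs)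

-- Diagonals of the residue are bounded by those of I: each surviving row
-- moved left by m and stayed in place.
diagonals-residue : (B i m : ℕ) (xs : List ℕ) → Descending xs → All (_≤ B) (diagonals i xs) →
  All (_≤ B) (diagonals (i + m) (strip (map (_∸ m) xs)))
diagonals-residue B i m []       _            _        = []
diagonals-residue B i m (x ∷ xs) (bnd ∷ desc) (d ∷ ds) with x ≤? m
... | yes x≤m rewrite strip-zeros (map (_∸ m) (x ∷ xs)) (All.map⁺ (All.map (λ y≤m → ≤-reflexive (m≤n⇒m∸n≡0 y≤m))
                                    (x≤m ∷ All.map (λ y≤x → ≤-trans y≤x x≤m) bnd))) = []
... | no x≰m rewrite filter-accept nonzero? {x ∸ m} {map (_∸ m) xs} (m>n⇒m∸n≢0 (≰⇒> x≰m)) =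
  subst (_≤ B) (sym same) d ∷ diagonals-residue B (suc i) m xs desc ds
  where
  same : x ∸ m + (i + m) ≡ x + i
  same = begin
    x ∸ m + (i + m) ≡⟨ cong (x ∸ m +_) (+-comm i m) ⟩
    x ∸ m + (m + i) ≡⟨ +-assoc (x ∸ m) m i ⟨
    x ∸ m + m + i   ≡⟨ cong (_+ i) (m∸n+n≡m (<⇒≤ (≰⇒> x≰m))) ⟩
    x + i           ∎
    where open ≡-Reasoning

-- The shape of the iterates: after m steps, ν^m(I) consists of m new rows on
-- top of the residue of I.  The step creating row t has length t + 1 plus
-- the number of rows of the residue at that time; later steps shorten it.
newRows : List ℕ → ℕ → List ℕ
newRows I zero    = []
newRows I (suc m) = suc (m + length (residue I m)) ∷ map (_∸ 1) (newRows I m)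

-- ν^m(I) is expected to be iterate I m.
iterate : List ℕ → ℕ → List ℕ
iterate I m = newRows I m ++ residue I m

length-newRows : (I : List ℕ) (m : ℕ) → length (newRows I m) ≡ m
length-newRows I zero    = refl
length-newRows I (suc m) = cong suc (trans (length-map (_∸ 1) (newRows I m)) (length-newRows I m))

length-iterate : (I : List ℕ) (m : ℕ) → length (iterate I m) ≡ m + length (residue I m)
length-iterate I m = trans (length-++ (newRows I m)) (cong (_+ length (residue I m)) (length-newRows I m))

νStep-iterate : (I : List ℕ) (m : ℕ) → All (2 ≤_) (newRows I m) → νStep (iterate I m) ≡ iterate I (suc m)
νStep-iterate I m long = cong₂ _∷_ (cong suc (length-iterate I m)) (begin
  strip (map (_∸ 1) (newRows I m ++ residue I m))
    ≡⟨ cong strip (map-++ (_∸ 1) (newRows I m) (residue I m)) ⟩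
  strip (map (_∸ 1) (newRows I m) ++ map (_∸ 1) (residue I m))
    ≡⟨ strip-++ (map (_∸ 1) (newRows I m)) (map (_∸ 1) (residue I m)) ⟩
  strip (map (_∸ 1) (newRows I m)) ++ dropCol (residue I m)
    ≡⟨ cong₂ _++_ (strip-positive (map (_∸ 1) (newRows I m)) (All.map⁺ (All.map (λ { (s≤s 1≤x) → 1≤x }) long)))
                  (dropCol-residue I m) ⟩
  map (_∸ 1) (newRows I m) ++ residue I (suc m) ∎)
  where open ≡-Reasoning

-- Invariant on the new rows up to step ℓ: row x after m steps satisfies
-- x + m > ℓ, i.e. it is still nonempty after the remaining ℓ - m steps.
Tall : ℕ → List ℕ → ℕ → Set
Tall ℓ I m = All (λ x → suc ℓ ≤ x + m) (newRows I m)

tall-step : (ℓ : ℕ) (I : List ℕ) (m : ℕ) → m < ℓ → ℓ ≤ m + length (residue I m) → Tall ℓ I m → Tall ℓ I (suc m)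
tall-step ℓ I m m<ℓ enough tall = s≤s (≤-trans enough (m≤m+n _ _)) ∷ All.map⁺ (shorten (newRows I m) tall)
  where
  shorten : ∀ xs → All (λ x → suc ℓ ≤ x + m) xs → All (λ x → suc ℓ ≤ (x ∸ 1) + suc m) xs
  shorten []           []         = []
  shorten (zero ∷ xs)  (h ∷ _)    = ⊥-elim (<⇒≱ m<ℓ (<⇒≤ h))
  shorten (suc x ∷ xs) (h ∷ hs)   = subst (suc ℓ ≤_) (sym (+-suc x m)) h ∷ shorten xs hs

-- Before step ℓ tall rows are at least 2 long, so ν does not delete them.
tall⇒≥2 : (ℓ : ℕ) (I : List ℕ) (m : ℕ) → m < ℓ → Tall ℓ I m → All (2 ≤_) (newRows I m)
tall⇒≥2 ℓ I m m<ℓ = All.map two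
  where
  two : ∀ {x} → suc ℓ ≤ x + m → 2 ≤ x
  two {zero}        h = ⊥-elim (<⇒≱ m<ℓ (<⇒≤ h))
  two {suc zero}    h = ⊥-elim (<⇒≱ m<ℓ (≤-pred h))
  two {suc (suc x)} h = s≤s (s≤s z≤n)

tall⇒positive : (ℓ : ℕ) (I : List ℕ) (m : ℕ) → m ≤ ℓ → Tall ℓ I m → Positive (newRows I m)
tall⇒positive ℓ I m m≤ℓ = All.map one
  where
  one : ∀ {x} → suc ℓ ≤ x + m → 1 ≤ x
  one {zero}  h = ⊥-elim (<⇒≱ (s≤s m≤ℓ) h)
  one {suc x} h = s≤s z≤n

positive-iterate : (ℓ : ℕ) (I : List ℕ) (m : ℕ) → m ≤ ℓ → Tall ℓ I m → Positive (iterate I m)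
positive-iterate ℓ I m m≤ℓ tall = All.++⁺ (tall⇒positive ℓ I m m≤ℓ tall) (strip-Positive (map (_∸ m) I))

newDiagonals : List ℕ → ℕ → List ℕ
newDiagonals I zero    = []
newDiagonals I (suc m) = (suc (m + length (residue I m)) + 1) ∷ newDiagonals I m

record IterateFacts (I : List ℕ) (ℓ m : ℕ) : Set where
  field
    computes   : νIter m I ≡ just (iterate I m)
    descending : Descending (iterate I m)
    tall       : Tall ℓ I m
    size≡      : size (iterate I m) ≡ size I + m
    dinv≡      : dinv (iterate I m) ≡ dinv I + m
    diagonals≡ : diagonals 1 (newRows I m) ≡ newDiagonals I m

iterate-start : (I : List ℕ) (ℓ : ℕ) → Positive I → Descending I → IterateFacts I ℓ 0
iterate-start I ℓ pos desc = record
  { computes   = cong just (sym start)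
  ; descending = subst Descending (sym start) desc
  ; tall       = []
  ; size≡      = trans (cong size start) (sym (+-identityʳ (size I)))
  ; dinv≡      = trans (cong dinv start) (sym (+-identityʳ (dinv I)))
  ; diagonals≡ = refl
  }
  where
  start : iterate I 0 ≡ I
  start = residue-0 I pos

iterate-step : (I : List ℕ) (ℓ m : ℕ) → m < ℓ →
  first (iterate I m) ≤ length (iterate I m) + 2 → ℓ ≤ m + length (residue I m) →
  IterateFacts I ℓ m → IterateFacts I ℓ (suc m)
iterate-step I ℓ m m<ℓ defined enough facts = record
  { computes   = trans (cong (_>>= ν) computes) (trans (ν-νStep γ pos defined) (cong just step))
  ; descending = subst Descending step (Descending-νStep γ descending defined)
  ; tall       = tall-step ℓ I m m<ℓ enough tall
  ; size≡      = trans (cong size (sym step)) (trans (size-νStep γ pos) (trans (cong suc size≡) (sym (+-suc _ m))))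
  ; dinv≡      = trans (cong dinv (sym step))
                   (trans (dinv-νStep γ descending pos defined) (trans (cong suc dinv≡) (sym (+-suc _ m))))
  ; diagonals≡ = cong (suc (m + length (residue I m)) + 1 ∷_) (trans (diagonals-dec 1 (newRows I m) (tall⇒positive ℓ I m (<⇒≤ m<ℓ) tall)) diagonals≡)
  }
  where
  open IterateFacts facts
  γ = iterate I m
  pos : Positive γ
  pos = positive-iterate ℓ I m (<⇒≤ m<ℓ) tall
  step : νStep γ ≡ iterate I (suc m)
  step = νStep-iterate I m (tall⇒≥2 ℓ I m m<ℓ tall)

iterate-upto : (I : List ℕ) (ℓ : ℕ) → Positive I → Descending I →
  (∀ m → m < ℓ → first (iterate I m) ≤ length (iterate I m) + 2) →
  (∀ m → m < ℓ → ℓ ≤ m + length (residue I m)) →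
  (m : ℕ) → m ≤ ℓ → IterateFacts I ℓ m
iterate-upto I ℓ pos desc defined enough zero    _   = iterate-start I ℓ pos desc
iterate-upto I ℓ pos desc defined enough (suc m) m<ℓ =
  iterate-step I ℓ m m<ℓ (defined m m<ℓ) (enough m m<ℓ) (iterate-upto I ℓ pos desc defined enough m (<⇒≤ m<ℓ))

diagonals-iterate : (I : List ℕ) (ℓ m : ℕ) → IterateFacts I ℓ m →
  diagonals 1 (iterate I m) ≡ newDiagonals I m ++ diagonals (suc m) (residue I m)
diagonals-iterate I ℓ m facts = begin
  diagonals 1 (newRows I m ++ residue I m)
    ≡⟨ diagonals-++ 1 (newRows I m) (residue I m) ⟩
  diagonals 1 (newRows I m) ++ diagonals (length (newRows I m) + 1) (residue I m)
    ≡⟨ cong₂ (λ xs z → xs ++ diagonals z (residue I m)) (IterateFacts.diagonals≡ facts)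
             (trans (cong (_+ 1) (length-newRows I m)) (+-comm m 1)) ⟩
  newDiagonals I m ++ diagonals (suc m) (residue I m) ∎
  where open ≡-Reasoning

triangle : ℕ → ℕ
triangle zero    = 0
triangle (suc n) = suc n + triangle n

bumped : ℕ → ℕ → List ℕ
bumped zero    n       = down n
bumped (suc r) zero    = []
bumped (suc r) (suc n) = suc (suc n) ∷ bumped r n

-- 𝕀_{k,ℓ} for ℓ = n+1, k = qℓ + r: q+1 rows of length ℓ above bumped r n.
shapeI : ℕ → ℕ → ℕ → List ℕ
shapeI q r n = replicate (suc q) (suc n) ++ bumped r n

addPad-replicate : (a x : ℕ) (xs ys : List ℕ) →
  addPad (replicate a x ++ xs) (replicate a 0 ++ ys) ≡ replicate a x ++ addPad xs ys
addPad-replicate zero    x xs ys = refl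
addPad-replicate (suc a) x xs ys = cong₂ _∷_ (+-identityʳ x) (addPad-replicate a x xs ys)

addPad-bumped : (r n : ℕ) → r ≤ n → addPad (down n) (replicate r 1 ++ replicate (n ∸ r) 0) ≡ bumped r n
addPad-bumped zero    n       _       = unpadded n
  where
  unpadded : ∀ n → addPad (down n) (replicate n 0) ≡ down n
  unpadded zero    = refl
  unpadded (suc n) = cong₂ _∷_ (+-identityʳ (suc n)) (unpadded n)
addPad-bumped (suc r) (suc n) (s≤s r≤n) = cong₂ _∷_ (+-comm (suc n) 1) (addPad-bumped r n r≤n)

𝕀-shapeI : (k n : ℕ) → 𝕀 k (suc n) ≡ shapeI (k / suc n) (k % suc n) n
𝕀-shapeI k n = trans (addPad-replicate (suc (k / suc n)) (suc n) (down n) _)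
  (cong (replicate (suc (k / suc n)) (suc n) ++_) (addPad-bumped (k % suc n) n (≤-pred (m%n<n k (suc n)))))

down-bounded : (n : ℕ) → All (_≤ n) (down n)
down-bounded zero    = []
down-bounded (suc n) = ≤-refl ∷ All.map (λ p≤n → ≤-trans p≤n (n≤1+n n)) (down-bounded n)

bumped-bounded : (r n : ℕ) → r ≤ n → All (_≤ suc n) (bumped r n)
bumped-bounded zero    n       _         = All.map (λ p≤n → ≤-trans p≤n (n≤1+n n)) (down-bounded n)
bumped-bounded (suc r) (suc n) (s≤s r≤n) = ≤-refl ∷ All.map (λ p≤ → ≤-trans p≤ (n≤1+n _)) (bumped-bounded r n r≤n)

bumped-Descending : (r n : ℕ) → r ≤ n → Descending (bumped r n)
bumped-Descending zero    zero    _         = []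
bumped-Descending zero    (suc n) _         = bumped-bounded zero n z≤n ∷ bumped-Descending zero n z≤n
bumped-Descending (suc r) (suc n) (s≤s r≤n) = All.map (λ p≤ → ≤-trans p≤ (n≤1+n _)) (bumped-bounded r n r≤n) ∷ bumped-Descending r n r≤n

bumped-Positive : (r n : ℕ) → r ≤ n → Positive (bumped r n)
bumped-Positive zero    zero    _         = []
bumped-Positive zero    (suc n) _         = s≤s z≤n ∷ bumped-Positive zero n z≤n
bumped-Positive (suc r) (suc n) (s≤s r≤n) = s≤s z≤n ∷ bumped-Positive r n r≤n

shapeI-Descending : (q r n : ℕ) → r ≤ n → Descending (shapeI q r n)
shapeI-Descending q r n r≤n = fullRows (suc q)
  where
  fullRows : ∀ a → Descending (replicate a (suc n) ++ bumped r n)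
  fullRows zero    = bumped-Descending r n r≤n
  fullRows (suc a) = All.++⁺ (All.replicate⁺ a ≤-refl) (bumped-bounded r n r≤n) ∷ fullRows a

shapeI-Positive : (q r n : ℕ) → r ≤ n → Positive (shapeI q r n)
shapeI-Positive q r n r≤n = All.++⁺ (All.replicate⁺ (suc q) (s≤s z≤n)) (bumped-Positive r n r≤n)

shapeI-size : (q r n : ℕ) → r ≤ n → size (shapeI q r n) ≡ suc q * suc n + (triangle n + r)
shapeI-size q r n r≤n = trans (sum-++ (replicate (suc q) (suc n)) (bumped r n))
  (cong₂ _+_ (sum-replicate (suc q) (suc n)) (bumped-sum r n r≤n))
  where
  sum-replicate : ∀ a x → sum (replicate a x) ≡ a * x
  sum-replicate zero    x = refl
  sum-replicate (suc a) x = cong (x +_) (sum-replicate a x)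
  down-sum : ∀ n → sum (down n) ≡ triangle n
  down-sum zero    = refl
  down-sum (suc n) = cong (suc n +_) (down-sum n)
  bumped-sum : ∀ r n → r ≤ n → sum (bumped r n) ≡ triangle n + r
  bumped-sum zero    n       _         = trans (down-sum n) (sym (+-identityʳ _))
  bumped-sum (suc r) (suc n) (s≤s r≤n) = trans (cong (suc (suc n) +_) (bumped-sum r n r≤n))
    (solve 3 (λ n t r → con 2 :+ n :+ (t :+ r) := con 1 :+ n :+ t :+ (con 1 :+ r)) refl n (triangle n) r)

conj-down : (n j : ℕ) → 1 ≤ j → conj (down n) j ≡ suc n ∸ j
conj-down zero    (suc j) _   = sym (0∸n≡0 j)
conj-down (suc n) j       1≤j with j ≤? suc n
... | yes j≤ = trans (conj-∷-≤ (suc n) (down n) j j≤)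
                     (trans (cong suc (conj-down n j 1≤j)) (sym (+-∸-assoc 1 j≤)))
... | no j≰ = trans (conj-∷ (suc n) (down n) j)
               (trans (cong (_+ conj (down n) j) (χ-no (j ≤? suc n) j≰))
               (trans (conj-down n j 1≤j)
               (trans (m≤n⇒m∸n≡0 (<⇒≤ (≰⇒> j≰))) (sym (m≤n⇒m∸n≡0 (≰⇒> j≰))))))

conj-bumped : (r n j : ℕ) → r ≤ n → 1 ≤ j → j ≤ suc n →
  conj (bumped r n) j + χ (j ≤? suc n ∸ r) ≡ suc (suc n) ∸ j
conj-bumped zero n j _ 1≤j j≤ =
  trans (cong₂ _+_ (conj-down n j 1≤j) (χ-yes (j ≤? suc n) j≤))
        (trans (+-comm _ 1) (sym (+-∸-assoc 1 j≤)))
conj-bumped (suc r) (suc n) j (s≤s r≤n) 1≤j j≤ with j ≤? suc n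
... | yes j≤n = trans (cong (_+ χ (j ≤? suc n ∸ r)) (conj-∷-≤ (suc (suc n)) (bumped r n) j j≤))
                      (trans (cong suc (conj-bumped r n j r≤n 1≤j j≤n)) (sym (+-∸-assoc 1 (m≤n⇒m≤1+n j≤n))))
... | no j≰n = begin
  conj (bumped (suc r) (suc n)) j + χ (j ≤? suc n ∸ r)
    ≡⟨ cong₂ _+_ (conj-∷-≤ (suc (suc n)) (bumped r n) j j≤)
                 (χ-no (j ≤? suc n ∸ r) (λ j≤′ → j≰n (≤-trans j≤′ (m∸n≤m (suc n) r)))) ⟩
  suc (conj (bumped r n) j) + 0
    ≡⟨ cong (λ c → suc c + 0) (conj-beyond (suc n) (bumped r n) j (bumped-bounded r n r≤n) (≰⇒> j≰n)) ⟩
  1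
    ≡⟨ sym (trans (cong (suc (suc (suc n)) ∸_) lastCol) (m+n∸n≡m 1 (suc (suc n)))) ⟩
  suc (suc (suc n)) ∸ j ∎
  where
  open ≡-Reasoning
  lastCol : j ≡ suc (suc n)
  lastCol = ≤-antisym j≤ (≰⇒> j≰n)

-- dinv of the staircase: every cell has arm = leg.
dinv-down : (n : ℕ) → dinv (down n) ≡ triangle n
dinv-down zero    = refl
dinv-down (suc n) = trans (dinv-prepend (suc n) (down n) (All.map (λ p≤ → ≤-trans p≤ (n≤1+n n)) (down-bounded n)))
  (cong₂ _+_ (sumFrom-ones _ 1 (suc n) (λ j 1≤j _ →
                trans (cong (dinvCell (suc n ∸ j)) (conj-down n j 1≤j)) (dinvCell-one (suc n ∸ j) 0 _ z≤n (+-identityʳ _))))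
             (dinv-down n))

-- dinv of bumped r n: again every cell counts.
dinv-bumped : (r n : ℕ) → r ≤ n → dinv (bumped r n) ≡ triangle n + r
dinv-bumped zero    n       _         = trans (dinv-down n) (sym (+-identityʳ _))
dinv-bumped (suc r) (suc n) (s≤s r≤n) =
  trans (dinv-prepend (suc (suc n)) (bumped r n) (All.map (λ p≤ → ≤-trans p≤ (n≤1+n _)) (bumped-bounded r n r≤n)))
   (trans (cong₂ _+_ (sumFrom-ones _ 1 (suc (suc n)) everyCell) (dinv-bumped r n r≤n))
     (solve 3 (λ n t r → con 2 :+ n :+ (t :+ r) := con 1 :+ n :+ t :+ (con 1 :+ r)) refl n (triangle n) r))
  where
  everyCell : ∀ j → 1 ≤ j → j < 1 + suc (suc n) → dinvCell (suc (suc n) ∸ j) (conj (bumped r n) j) ≡ 1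
  everyCell j 1≤j j< with j ≤? suc n
  ... | yes j≤ = dinvCell-one _ _ _ (χ≤1 (j ≤? suc n ∸ r)) (conj-bumped r n j r≤n 1≤j j≤)
  ... | no j≰  = dinvCell-one _ 0 _ z≤n (trans (+-identityʳ _)
                   (trans (conj-beyond (suc n) (bumped r n) j (bumped-bounded r n r≤n) (≰⇒> j≰))
                          (sym (trans (cong (suc (suc n) ∸_) (≤-antisym (≤-pred j<) (≰⇒> j≰))) (n∸n≡0 (suc (suc n)))))))

conj-bumped-low : (r n j : ℕ) → r ≤ n → 1 ≤ j → j ≤ suc n ∸ r → conj (bumped r n) j ≡ suc n ∸ j
conj-bumped-low r n j r≤n 1≤j j≤ = suc-injective (begin
  suc (conj (bumped r n) j)                ≡⟨ +-comm 1 _ ⟩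
  conj (bumped r n) j + 1                  ≡⟨ cong (conj (bumped r n) j +_) (χ-yes (j ≤? suc n ∸ r) j≤) ⟨
  conj (bumped r n) j + χ (j ≤? suc n ∸ r) ≡⟨ conj-bumped r n j r≤n 1≤j j≤sn ⟩
  suc (suc n) ∸ j                          ≡⟨ +-∸-assoc 1 j≤sn ⟩
  suc (suc n ∸ j)                          ∎)
  where
  open ≡-Reasoning
  j≤sn = ≤-trans j≤ (m∸n≤m (suc n) r)

conj-bumped-high : (r n j : ℕ) → r ≤ n → suc n ∸ r < j → j ≤ suc n → conj (bumped r n) j ≡ suc (suc n ∸ j)
conj-bumped-high r n j r≤n lo j≤sn = begin
  conj (bumped r n) j                      ≡⟨ +-identityʳ _ ⟨
  conj (bumped r n) j + 0                  ≡⟨ cong (conj (bumped r n) j +_) (χ-no (j ≤? suc n ∸ r) (<⇒≱ lo)) ⟨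
  conj (bumped r n) j + χ (j ≤? suc n ∸ r) ≡⟨ conj-bumped r n j r≤n (≤-trans (s≤s z≤n) lo) j≤sn ⟩
  suc (suc n) ∸ j                          ≡⟨ +-∸-assoc 1 j≤sn ⟩
  suc (suc n ∸ j)                          ∎
  where open ≡-Reasoning

-- A full row of length n+1 directly above bumped r n: exactly its first
-- n + 1 - r cells count for dinv (arm = leg there, leg = arm + 1 beyond).
topRow-over-bumped : (r n : ℕ) → r ≤ n →
  sumFrom (λ j → dinvCell (suc n ∸ j) (conj (bumped r n) j)) 1 (suc n) ≡ suc n ∸ r
topRow-over-bumped r n r≤n = begin
  sumFrom f 1 (suc n)                              ≡⟨ cong (sumFrom f 1) (m∸n+n≡m r≤sn) ⟨
  sumFrom f 1 (suc n ∸ r + r)                      ≡⟨ sumFrom-split f 1 (suc n ∸ r) r ⟩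
  sumFrom f 1 (suc n ∸ r) + sumFrom f (suc n ∸ r + 1) r
    ≡⟨ cong₂ _+_ (sumFrom-ones f 1 (suc n ∸ r) counted) (sumFrom-zeros f (suc n ∸ r + 1) r uncounted) ⟩
  suc n ∸ r + 0                                    ≡⟨ +-identityʳ _ ⟩
  suc n ∸ r                                        ∎
  where
  open ≡-Reasoning
  r≤sn = m≤n⇒m≤1+n r≤n
  f : ℕ → ℕ
  f j = dinvCell (suc n ∸ j) (conj (bumped r n) j)
  counted : ∀ j → 1 ≤ j → j < 1 + (suc n ∸ r) → f j ≡ 1
  counted j 1≤j j< = dinvCell-one _ 0 _ z≤n (trans (+-identityʳ _) (conj-bumped-low r n j r≤n 1≤j (≤-pred j<)))
  uncounted : ∀ j → suc n ∸ r + 1 ≤ j → j < suc n ∸ r + 1 + r → f j ≡ 0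
  uncounted j lo hi = dinvCell-zero _ _ (subst (suc n ∸ j <_) (sym (conj-bumped-high r n j r≤n lo′ j≤sn)) (n<1+n _))
    where
    lo′ = subst (_≤ j) (+-comm (suc n ∸ r) 1) lo
    j≤sn = ≤-pred (subst (j <_) (trans (cong (_+ r) (+-comm (suc n ∸ r) 1)) (cong suc (m∸n+n≡m r≤sn))) hi)

-- Further full rows on top contribute nothing: their cells have leg > arm.
dinv-fullRows : (r n : ℕ) → r ≤ n → (a : ℕ) →
  dinv (replicate (suc a) (suc n) ++ bumped r n) ≡ dinv (bumped r n) + (suc n ∸ r)
dinv-fullRows r n r≤n zero =
  trans (dinv-prepend (suc n) (bumped r n) (bumped-bounded r n r≤n))
        (trans (cong (_+ dinv (bumped r n)) (topRow-over-bumped r n r≤n)) (+-comm (suc n ∸ r) _))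
dinv-fullRows r n r≤n (suc a) =
  trans (dinv-prepend (suc n) (replicate (suc a) (suc n) ++ bumped r n)
          (All.++⁺ (All.replicate⁺ (suc a) ≤-refl) (bumped-bounded r n r≤n)))
        (cong₂ _+_ (sumFrom-zeros _ 1 (suc n) noCell) (dinv-fullRows r n r≤n a))
  where
  noCell : ∀ j → 1 ≤ j → j < 1 + suc n →
    dinvCell (suc n ∸ j) (conj (replicate (suc a) (suc n) ++ bumped r n) j) ≡ 0
  noCell j 1≤j j< = dinvCell-zero _ _ (subst (suc n ∸ j <_) (sym height) arm<)
    where
    j≤ = ≤-pred j<
    c = conj (bumped r n) j
    height : conj (replicate (suc a) (suc n) ++ bumped r n) j ≡ suc a + c
    height = trans (conj-++ (replicate (suc a) (suc n)) (bumped r n) j)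
                   (cong (_+ c) (conj-replicate (suc a) (suc n) j j≤))
    arm< : suc n ∸ j < suc a + c
    arm< = subst (_≤ suc a + c) (trans (conj-bumped r n j r≤n 1≤j j≤) (+-∸-assoc 1 j≤))
             (≤-trans (+-monoʳ-≤ c (χ≤1 (j ≤? suc n ∸ r)))
               (≤-trans (≤-reflexive (+-comm c 1)) (s≤s (m≤n+m c a))))

shapeI-dinv : (q r n : ℕ) → r ≤ n → dinv (shapeI q r n) ≡ triangle (suc n)
shapeI-dinv q r n r≤n = begin
  dinv (shapeI q r n)                 ≡⟨ dinv-fullRows r n r≤n q ⟩
  dinv (bumped r n) + (suc n ∸ r)     ≡⟨ cong (_+ (suc n ∸ r)) (dinv-bumped r n r≤n) ⟩
  triangle n + r + (suc n ∸ r)        ≡⟨ +-assoc (triangle n) r _ ⟩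
  triangle n + (r + (suc n ∸ r))      ≡⟨ cong (triangle n +_) (m+[n∸m]≡n (m≤n⇒m≤1+n r≤n)) ⟩
  triangle n + suc n                  ≡⟨ +-comm (triangle n) (suc n) ⟩
  triangle (suc n)                    ∎
  where open ≡-Reasoning

-- reach I m = m + ℓ(residue), one less than the length of the row created
-- by the (m+1)-st application of ν.
reach : List ℕ → ℕ → ℕ
reach I m = m + length (residue I m)

-- For 𝕀 = shapeI q r n the reach is constant up to a 0/1 correction:
-- column m+1 of 𝕀 has q + 1 + (n + 1 - m) cells, less one if m < n + 1 - r.
shapeI-reach : (q r n m : ℕ) → r ≤ n → m ≤ n →
  reach (shapeI q r n) m + χ (suc m ≤? suc n ∸ r) ≡ suc q + suc n
shapeI-reach q r n m r≤n m≤n = begin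
  m + length (residue I m) + b   ≡⟨ cong (λ z → m + z + b) (length-residue I m) ⟩
  m + conj I (suc m) + b         ≡⟨ cong (λ z → m + z + b) column ⟩
  m + (suc q + c) + b            ≡⟨ regroup m (suc q) c b ⟩
  suc q + ((c + b) + m)          ≡⟨ cong (λ z → suc q + (z + m)) (conj-bumped r n (suc m) r≤n (s≤s z≤n) (s≤s m≤n)) ⟩
  suc q + ((suc n ∸ m) + m)      ≡⟨ cong (suc q +_) (m∸n+n≡m (m≤n⇒m≤1+n m≤n)) ⟩
  suc q + suc n                  ∎
  where
  open ≡-Reasoning
  I = shapeI q r n
  b = χ (suc m ≤? suc n ∸ r)
  c = conj (bumped r n) (suc m)
  column : conj I (suc m) ≡ suc q + c
  column = trans (conj-++ (replicate (suc q) (suc n)) (bumped r n) (suc m))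
                 (cong (_+ c) (conj-replicate (suc q) (suc n) (suc m) (s≤s m≤n)))
  regroup : ∀ m q c b → m + (q + c) + b ≡ q + ((c + b) + m)
  regroup = solve 4 (λ m q c b → m :+ (q :+ c) :+ b := q :+ ((c :+ b) :+ m)) refl

shapeI-enough : (q r n : ℕ) → r ≤ n → (m : ℕ) → m < suc n → suc n ≤ reach (shapeI q r n) m
shapeI-enough q r n r≤n m m<ℓ = +-cancelʳ-≤ 1 _ _ (begin
  suc n + 1                      ≡⟨ +-comm (suc n) 1 ⟩
  suc (suc n)                    ≤⟨ s≤s (m≤n+m (suc n) q) ⟩
  suc q + suc n                  ≡⟨ shapeI-reach q r n m r≤n (≤-pred m<ℓ) ⟨
  reach I m + χ (suc m ≤? suc n ∸ r) ≤⟨ +-monoʳ-≤ (reach I m) (χ≤1 (suc m ≤? suc n ∸ r)) ⟩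
  reach I m + 1                  ∎)
  where
  open ≤-Reasoning
  I = shapeI q r n

-- ν is defined on each of the first ℓ iterates: the first row, of length
-- reach(m-1) + 1, is at most the number of rows reach(m) plus two.
shapeI-defined : (q r n : ℕ) → r ≤ n → (m : ℕ) → m < suc n →
  first (iterate (shapeI q r n) m) ≤ length (iterate (shapeI q r n) m) + 2
shapeI-defined q r n r≤n zero m<ℓ =
  subst (_≤ length (residue I 0) + 2) (cong first (sym (residue-0 I (shapeI-Positive q r n r≤n))))
        (≤-trans (shapeI-enough q r n r≤n 0 m<ℓ) (m≤m+n _ 2))
  where I = shapeI q r n
shapeI-defined q r n r≤n (suc m) m<ℓ = begin
  suc (reach I m)                                       ≤⟨ s≤s (m≤m+n (reach I m) _) ⟩
  suc (reach I m + χ (suc m ≤? suc n ∸ r))              ≡⟨ cong suc (trans (shapeI-reach q r n m r≤n (≤-pred (<⇒≤ m<ℓ)))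
                                                                 (sym (shapeI-reach q r n (suc m) r≤n (≤-pred m<ℓ)))) ⟩
  suc (reach I (suc m) + χ (suc (suc m) ≤? suc n ∸ r))   ≤⟨ s≤s (+-monoʳ-≤ (reach I (suc m)) (χ≤1 _)) ⟩
  suc (reach I (suc m) + 1)                             ≡⟨ +-suc (reach I (suc m)) 1 ⟨
  reach I (suc m) + 2                                   ≡⟨ cong (_+ 2) (length-iterate I (suc m)) ⟨
  length (iterate I (suc m)) + 2                        ∎
  where
  open ≤-Reasoning
  I = shapeI q r n

-- Suppose the reach of I is ℓ + c - 1 before step
-- r′ and ℓ + c from then on, and the largest diagonal of I is ℓ + c + 1
-- (here ℓ = n + 1).  The row created at step t ends on the diagonal
-- reach(t) + 2, the residue's diagonals do not grow, so Δ(ν^m I) is ℓ + c + 1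
-- up to step r′ and ℓ + c + 2 afterwards.
module IterateΔ (I : List ℕ) (n c r′ : ℕ) (desc : Descending I) (pos : Positive I)
  (reachLaw : ∀ t → t ≤ n → reach I t + χ (suc t ≤? r′) ≡ suc n + c)
  (bounded  : All (_≤ suc n + c + 1) (diagonals 1 I))
  (attained : Any (suc n + c + 1 ≤_) (diagonals 1 I)) where

  early-diagonal : (t : ℕ) → t ≤ n → suc t ≤ r′ → suc (reach I t) + 1 ≡ suc n + c + 1
  early-diagonal t t≤n early = cong (_+ 1) (begin
    suc (reach I t)               ≡⟨ +-comm 1 (reach I t) ⟩
    reach I t + 1                 ≡⟨ cong (reach I t +_) (χ-yes (suc t ≤? r′) early) ⟨
    reach I t + χ (suc t ≤? r′)   ≡⟨ reachLaw t t≤n ⟩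
    suc n + c                     ∎)
    where open ≡-Reasoning

  late-diagonal : (t : ℕ) → t ≤ n → ¬ (suc t ≤ r′) → suc (reach I t) + 1 ≡ suc n + c + 2
  late-diagonal t t≤n late = begin
    suc (reach I t) + 1           ≡⟨ +-suc (reach I t) 1 ⟨
    reach I t + 2                 ≡⟨ cong (λ z → z + 2) (begin
      reach I t                   ≡⟨ +-identityʳ (reach I t) ⟨
      reach I t + 0               ≡⟨ cong (reach I t +_) (χ-no (suc t ≤? r′) late) ⟨
      reach I t + χ (suc t ≤? r′) ≡⟨ reachLaw t t≤n ⟩
      suc n + c                   ∎) ⟩
    suc n + c + 2                 ∎
    where open ≡-Reasoning

  newDiagonals-bounded : (D m : ℕ) → (∀ t → t < m → suc (reach I t) + 1 ≤ D) → All (_≤ D) (newDiagonals I m)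
  newDiagonals-bounded D zero    _   = []
  newDiagonals-bounded D (suc m) bnd = bnd m ≤-refl ∷ newDiagonals-bounded D m (λ t t<m → bnd t (m≤n⇒m≤1+n t<m))

  Δ-early : (m : ℕ) → m ≤ suc n → IterateFacts I (suc n) m → m ≤ r′ → IsΔ (iterate I m) (suc n + c + 1)
  Δ-early m m≤ℓ facts m≤r′ = Δ-from-diagonals (iterate I m) _ (positive-iterate (suc n) I m m≤ℓ (IterateFacts.tall facts))
    (subst (All (_≤ suc n + c + 1)) (sym split)
      (All.++⁺ (newDiagonals-bounded _ m (λ t t<m → ≤-reflexive (early-diagonal t (≤-pred (≤-trans t<m m≤ℓ)) (≤-trans t<m m≤r′))))
               (diagonals-residue _ 1 m I desc bounded)))
    (witness m m≤ℓ m≤r′ split)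
    where
    split = diagonals-iterate I (suc n) m facts
    witness : ∀ m → m ≤ suc n → m ≤ r′ → diagonals 1 (iterate I m) ≡ newDiagonals I m ++ diagonals (suc m) (residue I m) →
      Any (suc n + c + 1 ≤_) (diagonals 1 (iterate I m))
    witness zero     _   _     _  = subst (Any (suc n + c + 1 ≤_) ∘ diagonals 1) (sym (residue-0 I pos)) attained
    witness (suc m′) m≤ℓ m≤r′ eq = subst (Any (suc n + c + 1 ≤_)) (sym eq)
      (here (≤-reflexive (sym (early-diagonal m′ (≤-pred m≤ℓ) m≤r′))))

  Δ-late : (m : ℕ) → m ≤ suc n → IterateFacts I (suc n) m → suc r′ ≤ m → IsΔ (iterate I m) (suc n + c + 2)
  Δ-late m m≤ℓ facts r′<m = Δ-from-diagonals (iterate I m) _ (positive-iterate (suc n) I m m≤ℓ (IterateFacts.tall facts))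
    (subst (All (_≤ suc n + c + 2)) (sym split)
      (All.++⁺ (newDiagonals-bounded _ m newBound)
               (All.map (λ d≤ → ≤-trans d≤ (+-monoʳ-≤ (suc n + c) (s≤s z≤n))) (diagonals-residue _ 1 m I desc bounded))))
    (witness m m≤ℓ r′<m split)
    where
    split = diagonals-iterate I (suc n) m facts
    -- every new row ends on diagonal ℓ + c + 1 or ℓ + c + 2
    newBound : ∀ t → t < m → suc (reach I t) + 1 ≤ suc n + c + 2
    newBound t t<m = begin
      suc (reach I t) + 1 ≡⟨ +-suc (reach I t) 1 ⟨
      reach I t + 2       ≤⟨ +-monoˡ-≤ 2 (m≤m+n (reach I t) _) ⟩
      reach I t + χ (suc t ≤? r′) + 2 ≡⟨ cong (_+ 2) (reachLaw t (≤-pred (≤-trans t<m m≤ℓ))) ⟩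
      suc n + c + 2       ∎
      where open ≤-Reasoning
    witness : ∀ m → m ≤ suc n → suc r′ ≤ m → diagonals 1 (iterate I m) ≡ newDiagonals I m ++ diagonals (suc m) (residue I m) →
      Any (suc n + c + 2 ≤_) (diagonals 1 (iterate I m))
    witness (suc m′) m≤ℓ r′<m eq = subst (Any (suc n + c + 2 ≤_)) (sym eq)
      (here (≤-reflexive (sym (late-diagonal m′ (≤-pred m≤ℓ) (λ early → <⇒≱ early (≤-pred r′<m))))))

diagonals-replicate-bounded : (a x i : ℕ) → All (_≤ x + i + a) (diagonals i (replicate (suc a) x))
diagonals-replicate-bounded zero    x i = ≤-reflexive (sym (+-identityʳ _)) ∷ []
diagonals-replicate-bounded (suc a) x i =
  m≤m+n (x + i) (suc a) ∷ All.map (λ d≤ → ≤-trans d≤ (≤-reflexive (shift x i a))) (diagonals-replicate-bounded a x (suc i))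
  where
  shift : ∀ x i a → x + suc i + a ≡ x + i + suc a
  shift = solve 3 (λ x i a → x :+ (con 1 :+ i) :+ a := x :+ i :+ (con 1 :+ a)) refl

diagonals-replicate-attained : (a x i : ℕ) → Any (x + i + a ≤_) (diagonals i (replicate (suc a) x))
diagonals-replicate-attained zero    x i = here (≤-reflexive (+-identityʳ _))
diagonals-replicate-attained (suc a) x i =
  there (subst (λ d → Any (d ≤_) (diagonals (suc i) (replicate (suc a) x))) (shift x i a) (diagonals-replicate-attained a x (suc i)))
  where
  shift : ∀ x i a → x + suc i + a ≡ x + i + suc a
  shift = solve 3 (λ x i a → x :+ (con 1 :+ i) :+ a := x :+ i :+ (con 1 :+ a)) refl

diagonals-down : (n i : ℕ) → All (_≤ n + i) (diagonals i (down n))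
diagonals-down zero    i = []
diagonals-down (suc n) i = ≤-refl ∷ All.map (λ d≤ → ≤-trans d≤ (≤-reflexive (+-suc n i))) (diagonals-down n (suc i))

diagonals-bumped : (r n i : ℕ) → r ≤ n → All (_≤ n + i + χ (1 ≤? r)) (diagonals i (bumped r n))
diagonals-bumped zero    n       i _ = All.map (λ d≤ → ≤-trans d≤ (≤-reflexive (sym (+-identityʳ _)))) (diagonals-down n i)
diagonals-bumped (suc r) (suc n) i (s≤s r≤n) =
  ≤-reflexive (head n i) ∷ All.map (λ d≤ → ≤-trans d≤ (≤-trans (+-monoʳ-≤ (n + suc i) (χ≤1 (1 ≤? r))) (≤-reflexive (tail n i))))
                                   (diagonals-bumped r n (suc i) r≤n)
  where
  head : ∀ n i → suc (suc n) + i ≡ suc n + i + 1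
  head = solve 2 (λ n i → con 2 :+ n :+ i := con 1 :+ n :+ i :+ con 1) refl
  tail : ∀ n i → n + suc i + 1 ≡ suc n + i + 1
  tail = solve 2 (λ n i → n :+ (con 1 :+ i) :+ con 1 := con 1 :+ n :+ i :+ con 1) refl

diagonals-bumped-attained : (r n i : ℕ) → suc r ≤ n → Any (n + i + 1 ≤_) (diagonals i (bumped (suc r) n))
diagonals-bumped-attained r (suc n) i _ =
  here (≤-reflexive (solve 2 (λ n i → con 1 :+ n :+ i :+ con 1 := con 2 :+ n :+ i) refl n i))

diagonals-shapeI : (q r n : ℕ) →
  diagonals 1 (shapeI q r n) ≡ diagonals 1 (replicate (suc q) (suc n)) ++ diagonals (suc q + 1) (bumped r n)
diagonals-shapeI q r n = trans (diagonals-++ 1 (replicate (suc q) (suc n)) (bumped r n))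
  (cong (λ z → diagonals 1 (replicate (suc q) (suc n)) ++ diagonals (z + 1) (bumped r n)) (length-replicate (suc q)))

-- With k = qℓ + r (ℓ = n + 1, 0 ≤ r < ℓ): ⌈k/ℓ⌉ = q and r_{-k,ℓ} = 0 when
-- ℓ divides k; otherwise ⌈k/ℓ⌉ = q + 1 and r_{-k,ℓ} = ℓ - r.
data Rounding (n q r c r′ : ℕ) : Set where
  exact   : r ≡ 0 → c ≡ q → r′ ≡ 0 → Rounding n q r c r′
  inexact : (r₀ : ℕ) → r ≡ suc r₀ → c ≡ suc q → r′ ≡ suc n ∸ suc r₀ → Rounding n q r c r′

div-exact : (R q n : ℕ) → R < suc n → (R + q * suc n) / suc n ≡ q
div-exact R q n R<ℓ = trans (+-distrib-/ R (q * suc n) noCarry) (cong₂ _+_ (m<n⇒m/n≡0 R<ℓ) (m*n/n≡m q (suc n)))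
  where
  noCarry : R % suc n + (q * suc n) % suc n < suc n
  noCarry = subst (_< suc n) (sym (trans (cong₂ _+_ (m<n⇒m%n≡m R<ℓ) (m*n%n≡0 q (suc n))) (+-identityʳ R))) R<ℓ

rounding : (k n : ℕ) → Rounding n (k / suc n) (k % suc n) (ceilDiv k (suc n)) (r (ℤ.- (ℤ.+ k)) (suc n))
rounding k n with k % suc n in rem
... | zero   = exact refl ceil (negRem k rem)
  where
  ceil : (k + n) / suc n ≡ k / suc n
  ceil = begin
    (k + n) / suc n                    ≡⟨ cong (λ z → (z + n) / suc n) (trans (m≡m%n+[m/n]*n k (suc n)) (cong (_+ (k / suc n) * suc n) rem)) ⟩
    ((k / suc n) * suc n + n) / suc n  ≡⟨ cong (_/ suc n) (+-comm ((k / suc n) * suc n) n) ⟩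
    (n + (k / suc n) * suc n) / suc n  ≡⟨ div-exact n (k / suc n) n ≤-refl ⟩
    k / suc n                          ∎
    where open ≡-Reasoning
  negRem : ∀ k → k % suc n ≡ 0 → r (ℤ.- (ℤ.+ k)) (suc n) ≡ 0
  negRem zero    _ = refl
  negRem (suc k) e with suc k % suc n | e
  ... | .0 | refl = refl
... | suc r₀ = inexact r₀ refl ceil (negRem k rem)
  where
  ceil : (k + n) / suc n ≡ suc (k / suc n)
  ceil = begin
    (k + n) / suc n                                 ≡⟨ cong (λ z → (z + n) / suc n) (trans (m≡m%n+[m/n]*n k (suc n)) (cong (_+ (k / suc n) * suc n) rem)) ⟩
    (suc r₀ + (k / suc n) * suc n + n) / suc n      ≡⟨ cong (_/ suc n) (regroup r₀ ((k / suc n) * suc n) n) ⟩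
    (r₀ + suc (k / suc n) * suc n) / suc n          ≡⟨ div-exact r₀ (suc (k / suc n)) n (<⇒≤ (subst (_< suc n) rem (m%n<n k (suc n)))) ⟩
    suc (k / suc n)                                 ∎
    where
    open ≡-Reasoning
    regroup : ∀ r x n → suc r + x + n ≡ r + (suc n + x)
    regroup = solve 3 (λ r x n → con 1 :+ r :+ x :+ n := r :+ (con 1 :+ n :+ x)) refl
  negRem : ∀ k → k % suc n ≡ suc r₀ → r (ℤ.- (ℤ.+ k)) (suc n) ≡ suc n ∸ suc r₀
  negRem zero    ()
  negRem (suc k) e with suc k % suc n | e
  ... | .(suc r₀) | refl = refl

shapeI-reachLaw : (n q r c r′ : ℕ) → r ≤ n → Rounding n q r c r′ →
  (t : ℕ) → t ≤ n → reach (shapeI q r n) t + χ (suc t ≤? r′) ≡ suc n + c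
shapeI-reachLaw n q r c r′ r≤n (exact refl refl refl) t t≤n = suc-injective (begin
  suc (reach I t + 0)              ≡⟨ cong suc (+-identityʳ (reach I t)) ⟩
  suc (reach I t)                  ≡⟨ +-comm 1 (reach I t) ⟩
  reach I t + 1                    ≡⟨ cong (reach I t +_) (χ-yes (suc t ≤? suc n) (s≤s t≤n)) ⟨
  reach I t + χ (suc t ≤? suc n)   ≡⟨ shapeI-reach q 0 n t z≤n t≤n ⟩
  suc q + suc n                    ≡⟨ cong suc (+-comm q (suc n)) ⟩
  suc (suc n + q)                  ∎)
  where
  open ≡-Reasoning
  I = shapeI q 0 n
shapeI-reachLaw n q r c r′ r≤n (inexact r₀ refl refl refl) t t≤n =
  trans (shapeI-reach q (suc r₀) n t r≤n t≤n) (+-comm (suc q) (suc n))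

-- The largest diagonal of 𝕀_{k,ℓ} is ℓ + ⌈k/ℓ⌉ + 1: the last full row
-- if ℓ divides k, the first bumped row otherwise.
shapeI-maxDiagonal : (n q r c r′ : ℕ) → r ≤ n → Rounding n q r c r′ →
  All (_≤ suc n + c + 1) (diagonals 1 (shapeI q r n)) × Any (suc n + c + 1 ≤_) (diagonals 1 (shapeI q r n))
shapeI-maxDiagonal n q r c r′ r≤n (exact refl refl refl) =
  subst (All (_≤ suc n + q + 1)) (sym (diagonals-shapeI q 0 n))
    (All.++⁺ (All.map (λ d≤ → ≤-trans d≤ (≤-reflexive fullRow)) (diagonals-replicate-bounded q (suc n) 1))
             (All.map (λ d≤ → ≤-trans d≤ (≤-reflexive bumpedRow)) (diagonals-bumped 0 n (suc q + 1) z≤n))) ,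
  subst (Any (suc n + q + 1 ≤_)) (sym (diagonals-shapeI q 0 n))
    (++⁺ˡ (subst (λ d → Any (d ≤_) (diagonals 1 (replicate (suc q) (suc n)))) fullRow (diagonals-replicate-attained q (suc n) 1)))
  where
  fullRow : suc n + 1 + q ≡ suc n + q + 1
  fullRow = solve 2 (λ n q → n :+ con 1 :+ q := n :+ q :+ con 1) refl (suc n) q
  bumpedRow : n + (suc q + 1) + 0 ≡ suc n + q + 1
  bumpedRow = solve 2 (λ n q → n :+ (con 1 :+ q :+ con 1) :+ con 0 := con 1 :+ n :+ q :+ con 1) refl n q
shapeI-maxDiagonal n q r c r′ r≤n (inexact r₀ refl refl refl) =
  subst (All (_≤ suc n + suc q + 1)) (sym (diagonals-shapeI q (suc r₀) n))
    (All.++⁺ (All.map (λ d≤ → ≤-trans d≤ fullRow) (diagonals-replicate-bounded q (suc n) 1))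
             (All.map (λ d≤ → ≤-trans d≤ (≤-reflexive bumpedRow)) (diagonals-bumped (suc r₀) n (suc q + 1) r≤n))) ,
  subst (Any (suc n + suc q + 1 ≤_)) (sym (diagonals-shapeI q (suc r₀) n))
    (++⁺ʳ (diagonals 1 (replicate (suc q) (suc n)))
      (subst (λ d → Any (d ≤_) (diagonals (suc q + 1) (bumped (suc r₀) n))) bumpedRow
             (diagonals-bumped-attained r₀ n (suc q + 1) r≤n)))
  where
  fullRow : suc n + 1 + q ≤ suc n + suc q + 1
  fullRow = ≤-trans (n≤1+n _) (≤-reflexive (solve 2 (λ n q → con 1 :+ (n :+ con 1 :+ q) := n :+ (con 1 :+ q) :+ con 1) refl (suc n) q))
  bumpedRow : n + (suc q + 1) + 1 ≡ suc n + suc q + 1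
  bumpedRow = solve 2 (λ n q → n :+ (con 1 :+ q :+ con 1) :+ con 1 := con 1 :+ n :+ (con 1 :+ q) :+ con 1) refl n q

triangle-choose : (ℓ : ℕ) → triangle ℓ ≡ suc ℓ C 2
triangle-choose zero    = refl
triangle-choose (suc ℓ) = trans (cong₂ _+_ (sym (nC1≡n (suc ℓ))) (triangle-choose ℓ)) (nCk+nC[k+1]≡[n+1]C[k+1] (suc ℓ) 1)

def-from-size : (γ : List ℕ) (k : ℕ) → size γ ≡ dinv γ + k → def γ ≡ ℤ.+ k
def-from-size γ k sizeEq = begin
  ℤ.+ size γ ℤ.- ℤ.+ dinv γ       ≡⟨ cong (λ s → ℤ.+ s ℤ.- ℤ.+ dinv γ) sizeEq ⟩
  ℤ.+ (dinv γ + k) ℤ.- ℤ.+ dinv γ ≡⟨ ℤ.[+m]-[+n]≡m⊖n (dinv γ + k) (dinv γ) ⟩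
  (dinv γ + k) ℤ.⊖ dinv γ         ≡⟨ ℤ.⊖-≥ (m≤m+n (dinv γ) k) ⟩
  ℤ.+ (dinv γ + k ∸ dinv γ)       ≡⟨ cong ℤ.+_ (m+n∸m≡n (dinv γ) k) ⟩
  ℤ.+ k                           ∎
  where open ≡-Reasoning

shapeI-size-dinv : (q r n : ℕ) → r ≤ n → size (shapeI q r n) ≡ dinv (shapeI q r n) + (r + q * suc n)
shapeI-size-dinv q r n r≤n = begin
  size (shapeI q r n)                     ≡⟨ shapeI-size q r n r≤n ⟩
  suc n + q * suc n + (triangle n + r)    ≡⟨ regroup (suc n) (q * suc n) (triangle n) r ⟩
  suc n + triangle n + (r + q * suc n)    ≡⟨ cong (λ d → d + (r + q * suc n)) (shapeI-dinv q r n r≤n) ⟨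
  dinv (shapeI q r n) + (r + q * suc n)   ∎
  where
  open ≡-Reasoning
  regroup : ∀ l x t r → l + x + (t + r) ≡ l + t + (r + x)
  regroup = solve 4 (λ l x t r → l :+ x :+ (t :+ r) := l :+ t :+ (r :+ x)) refl

shapeI-iterates : (k n q r c r′ : ℕ) → r ≤ n → k ≡ r + q * suc n → Rounding n q r c r′ →
  (m : ℕ) → m ≤ suc n →
  Σ (List ℕ) (λ γ → (νIter m (shapeI q r n) ≡ just γ) × (def γ ≡ ℤ.+ k) × (dinv γ ≡ (suc (suc n) C 2) + m)
                  × (m ≤ r′ → IsΔ γ (suc n + c + 1)) × (suc r′ ≤ m → IsΔ γ (suc n + c + 2)))
shapeI-iterates k n q r c r′ r≤n k≡ rounded m m≤ℓ =
  iterate I m , computes , def-from-size (iterate I m) k sizeEq , dinvEq , Δ-early m m≤ℓ facts , Δ-late m m≤ℓ facts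
  where
  I = shapeI q r n
  pos = shapeI-Positive q r n r≤n
  desc = shapeI-Descending q r n r≤n
  facts = iterate-upto I (suc n) pos desc (shapeI-defined q r n r≤n) (shapeI-enough q r n r≤n) m m≤ℓ
  maxDiagonal = shapeI-maxDiagonal n q r c r′ r≤n rounded
  open IterateFacts facts
  open IterateΔ I n c r′ desc pos (shapeI-reachLaw n q r c r′ r≤n rounded) (proj₁ maxDiagonal) (proj₂ maxDiagonal)
  dinvEq : dinv (iterate I m) ≡ (suc (suc n) C 2) + m
  dinvEq = trans dinv≡ (cong (_+ m) (trans (shapeI-dinv q r n r≤n) (triangle-choose (suc n))))
  sizeEq : size (iterate I m) ≡ dinv (iterate I m) + k
  sizeEq = begin
    size (iterate I m)   ≡⟨ size≡ ⟩
    size I + m           ≡⟨ cong (_+ m) (trans (shapeI-size-dinv q r n r≤n) (cong (dinv I +_) (sym k≡))) ⟩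
    dinv I + k + m       ≡⟨ +-assoc (dinv I) k m ⟩
    dinv I + (k + m)     ≡⟨ cong (dinv I +_) (+-comm k m) ⟩
    dinv I + (m + k)     ≡⟨ +-assoc (dinv I) m k ⟨
    dinv I + m + k       ≡⟨ cong (_+ k) dinv≡ ⟨
    dinv (iterate I m) + k ∎
    where open ≡-Reasoning

-- The integer notation of the statement; it is brought into scope only here
-- because its prefix + would clash with sections (n +_) on ℕ above.
open import Data.Integer using (+_; -_)

lemma2p6 : (k ℓ : ℕ) .{{_ : NonZero ℓ}} → (m : ℕ) → m ≤ ℓ →
    Σ Partition (λ γ →
      (νIter m (𝕀 k ℓ) ≡ just γ)
      × (def γ ≡ + k)
      × (dinv γ ≡ (suc ℓ C 2) + m)
      × (m ≤ r (- (+ k)) ℓ → IsΔ γ (ℓ + ceilDiv k ℓ + 1))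
      × (suc (r (- (+ k)) ℓ) ≤ m → IsΔ γ (ℓ + ceilDiv k ℓ + 2)))
lemma2p6 k zero    {{()}}
lemma2p6 k (suc n) m m≤ℓ
  with shapeI-iterates k n (k / suc n) (k % suc n) _ _ (≤-pred (m%n<n k (suc n)))
                       (m≡m%n+[m/n]*n k (suc n)) (rounding k n) m m≤ℓ
... | γ , computes , properties = γ , trans (cong (νIter m) (𝕀-shapeI k n)) computes , properties
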